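{- Let $q=p^m$ with $p$ an odd prime, let $k,f$ be positive integers with $q-1=kf$, and let $g$ be a generator of $\mathbb{F}_q^*$. (i) For all integers $i_1,i_2,i_3,i_4$, $$[i_1,i_2,i_3,i_4]_k=\gamma+\sum_{(v_1,v_2)\in\langle k\rangle^2}(v_2-v_1,-v_1)_k\,(i_2-i_1,v_1-i_1)_k\,(i_4-i_3,v_2-i_3)_k,$$ where $$\gamma=\begin{cases}(i_2-i_1,-i_1)_k f+(i_4-i_3,-i_3)_k f, & i_2-i_1\equiv \frac{kf}{2}\pmod k \text{ and } i_4-i_3\equiv\frac{kf}{2}\pmod k,\\ (i_2-i_1,-i_1)_k f, & i_2-i_1\not\equiv \frac{kf}{2}\pmod k \text{ and } i_4-i_3\equiv\frac{kf}{2}\pmod k,\\ (i_4-i_3,-i_3)_k f, & i_2-i_1\equiv \frac{kf}{2}\pmod k \text{ and } i_4-i_3\not\equiv\frac{kf}{2}\pmod k,\\ 0, & \text{otherwise}.\end{cases}$$ (ii) For every integer $i$, $$[i,i,i,i]_k=2\theta+\sum_{(v_1,v_2)\in\langle k\rangle^2}(v_2-v_1,-v_1)_k\,(0,v_1-i)_k\,(0,v_2-i)_k,$$ where $\theta=(0,-i)_k f$ if $f$ is even and $\theta=0$ if $f$ is odd.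
   Context: Notation: $\langle r\rangle=\{0,1,\dots,r-1\}$. For integers $i,j$, $(i,j)_k$ is the number of $(u_1,u_2)\in\langle f\rangle^2$ with $1+g^{ku_1+i}=g^{ku_2+j}$. For integers $i_1,\dots,i_n$, $[i_1,\dots,i_n]_k$ is the number of $(u_1,\dots,u_n)\in\langle f\rangle^n$ with $g^{ku_1+i_1}+\cdots+g^{ku_n+i_n}=1$. -}

module Defs where

open import Level using (Level; _⊔_) renaming (suc to lsuc)
open import Algebra.Bundles using (CommutativeRing)
open import Data.Nat as ℕ using (ℕ; zero; suc)
open import Data.Nat.Divisibility using (_∣?_)
open import Data.Integer as ℤ using (ℤ; +_; -[1+_]; ∣_∣)
open import Data.Integer.Divisibility as ℤD using ()
open import Data.Fin using (Fin; toℕ)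
open import Data.Product using (Σ; ∃; _×_)
open import Relation.Nullary using (¬_; Dec; yes; no)
open import Relation.Binary using (Decidable)

record DecField (c ℓ : Level) : Set (lsuc (c ⊔ ℓ)) where
  field
    commRing : CommutativeRing c ℓ
  open CommutativeRing commRing public
  field
    _≟_      : Decidable _≈_
    0≉1      : ¬ (0# ≈ 1#)
    _⁻¹      : Carrier → Carrier
    inverseʳ : ∀ x → ¬ (x ≈ 0#) → (x * (x ⁻¹)) ≈ 1#

module _ {c ℓ : Level} (F : DecField c ℓ) where
  open DecField F

  pow : Carrier → ℕ → Carrier
  pow x zero    = 1#
  pow x (suc n) = x * pow x n

  powℤ : Carrier → ℤ → Carrier
  powℤ x (+ n)      = pow x n
  powℤ x -[1+ n ]   = pow (x ⁻¹) (suc n)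

  HasSize : ℕ → Set (c ⊔ ℓ)
  HasSize q = Σ (Fin q → Carrier) λ e →
      (∀ a b → e a ≈ e b → a ≡F b)
    × (∀ x → ∃ λ a → e a ≈ x)
    where
      open import Relation.Binary.PropositionalEquality using (_≡_)
      _≡F_ : Fin q → Fin q → Set
      a ≡F b = a ≡ b

  IsGenerator : Carrier → Set (c ⊔ ℓ)
  IsGenerator g = ¬ (g ≈ 0#) × (∀ x → ¬ (x ≈ 0#) → ∃ λ (n : ℕ) → pow g n ≈ x)

-- finite sums over ⟨n⟩ = {0,…,n-1}

∑ : (n : ℕ) → (ℕ → ℕ) → ℕ
∑ zero    h = 0
∑ (suc n) h = ∑ n h ℕ.+ h n

χ : ∀ {a} {P : Set a} → Dec P → ℕ
χ (yes _) = 1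
χ (no _)  = 0

_≡_[mod_] : ℤ → ℤ → ℕ → Set
a ≡ b [mod k ] = (+ k) ℤD.∣ (a ℤ.- b)

_≡?_[mod_] : (a b : ℤ) (k : ℕ) → Dec (a ≡ b [mod k ])
a ≡? b [mod k ] = k ∣? ∣ a ℤ.- b ∣

module _ {c ℓ : Level} (F : DecField c ℓ) (g : DecField.Carrier F) (k f : ℕ) where
  open DecField F

  private
    G : ℤ → Carrier
    G = powℤ F g
    e : ℕ → ℤ → ℤ
    e u i = (+ k) ℤ.* (+ u) ℤ.+ i

  -- (i , j)_k = #{ (u1,u2) ∈ ⟨f⟩² : 1 + g^{k u1 + i} = g^{k u2 + j} }
  cyc : ℤ → ℤ → ℕ
  cyc i j = ∑ f λ u1 → ∑ f λ u2 → χ ((1# + G (e u1 i)) ≟ G (e u2 j))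

  -- [i1,i2,i3,i4]_k = #{ (u1,…,u4) ∈ ⟨f⟩⁴ : Σ g^{k uℓ + iℓ} = 1 }
  cyc4 : ℤ → ℤ → ℤ → ℤ → ℕ
  cyc4 i1 i2 i3 i4 =
    ∑ f λ u1 → ∑ f λ u2 → ∑ f λ u3 → ∑ f λ u4 →
      χ ((G (e u1 i1) + G (e u2 i2) + G (e u3 i3) + G (e u4 i4)) ≟ 1#)

  half : ℤ
  half = + ((k ℕ.* f) ℕ./ 2)

  γ : ℤ → ℤ → ℤ → ℤ → ℕ
  γ i1 i2 i3 i4 with (i2 ℤ.- i1) ≡? half [mod k ] | (i4 ℤ.- i3) ≡? half [mod k ]
  ... | yes _ | yes _ = cyc (i2 ℤ.- i1) (ℤ.- i1) ℕ.* f ℕ.+ cyc (i4 ℤ.- i3) (ℤ.- i3) ℕ.* f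
  ... | no _  | yes _ = cyc (i2 ℤ.- i1) (ℤ.- i1) ℕ.* f
  ... | yes _ | no _  = cyc (i4 ℤ.- i3) (ℤ.- i3) ℕ.* f
  ... | no _  | no _  = 0

  θ : ℤ → ℕ
  θ i with 2 ∣? f
  ... | yes _ = cyc (+ 0) (ℤ.- i) ℕ.* f
  ... | no _  = 0

module Submission where

-- Group the four terms into the pair sums s = g^{ku₁+i₁} + g^{ku₂+i₂} and t = g^{ku₃+i₃} + g^{ku₄+i₄}
-- with s + t = 1.  Since g^{kf/2} = −1, the pair sum s vanishes (for f choices of (u₁, u₂) each time)
-- exactly when i₂ − i₁ ≡ kf/2 (mod k), and then t = 1; with the symmetric case this gives γ.
-- Otherwise s = g^c and t = g^d with g^c + g^d = 1.  Dividing by g^{ku₁+i₁}, the number of pairs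
-- with sum g^c is the cyclotomic number (i₂ − i₁, c − i₁)_k, which only depends on c mod k; reducing
-- c and d mod k to v₁, v₂, the pairs (c, d) themselves are counted by (v₂ − v₁, −v₁)_k.
-- Part (ii) is the diagonal case, where 0 ≡ kf/2 (mod k) iff f is even.

open import Level using (Level)
open import Data.Nat as ℕ using (ℕ; zero; suc; _<_; _≤_; _≥_; _^_; NonZero)
import Data.Nat.Properties as ℕ
open import Data.Nat.DivMod using (_%_; _/_; m≡m%n+[m/n]*n; m%n<n; m/n*n≡m)
open import Data.Nat.Divisibility as ℕ∣ using (_∣_)
open import Data.Nat.Primality using (Prime; euclidsLemma; prime[2])
import Data.Nat.Tactic.RingSolver as ℕ-Solver
open import Data.Integer as ℤ using (ℤ; +_; -[1+_]; ∣_∣)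
import Data.Integer.Properties as ℤ
import Data.Integer.DivMod as ℤ
open import Data.Integer.Divisibility.Signed as ℤ∣ using (divides; ∣⇒∣ᵤ; ∣ᵤ⇒∣)
  renaming (_∣_ to _∣ℤ_; _∣?_ to _∣ℤ?_)
import Data.Integer.Tactic.RingSolver as ℤ-Solver
open import Data.Fin as Fin using (Fin; toℕ; fromℕ<; punchIn; punchOut)
import Data.Fin.Properties as Fin
open import Data.Product using (∃; _×_; _,_; proj₁; proj₂)
open import Data.Sum using (_⊎_; inj₁; inj₂)
open import Data.Empty using (⊥-elim)
open import Function using (_∘_)
open import Relation.Nullary using (¬_; Dec; yes; no)
open import Relation.Binary.Definitions using (tri<; tri≈; tri>)
open import Relation.Binary.PropositionalEquality as ≡ using (_≡_; _≢_; module ≡-Reasoning)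

open import Defs

∑-cong-< : ∀ n {h h′ : ℕ → ℕ} → (∀ i → i < n → h i ≡ h′ i) → ∑ n h ≡ ∑ n h′
∑-cong-< zero    eq = ≡.refl
∑-cong-< (suc n) eq = ≡.cong₂ ℕ._+_ (∑-cong-< n (λ i i<n → eq i (ℕ.m<n⇒m<1+n i<n))) (eq n ℕ.≤-refl)

∑-cong : ∀ n {h h′ : ℕ → ℕ} → (∀ i → h i ≡ h′ i) → ∑ n h ≡ ∑ n h′
∑-cong n eq = ∑-cong-< n (λ i _ → eq i)

∑-distrib-+ : ∀ n (h h′ : ℕ → ℕ) → ∑ n (λ i → h i ℕ.+ h′ i) ≡ ∑ n h ℕ.+ ∑ n h′
∑-distrib-+ zero    h h′ = ≡.refl
∑-distrib-+ (suc n) h h′ rewrite ∑-distrib-+ n h h′ = shuffle (∑ n h) (∑ n h′) (h n) (h′ n)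
  where
    shuffle : ∀ A B a b → A ℕ.+ B ℕ.+ (a ℕ.+ b) ≡ A ℕ.+ a ℕ.+ (B ℕ.+ b)
    shuffle = ℕ-Solver.solve-∀

∑-*ˡ : ∀ n c (h : ℕ → ℕ) → ∑ n (λ i → c ℕ.* h i) ≡ c ℕ.* ∑ n h
∑-*ˡ zero    c h = ≡.sym (ℕ.*-zeroʳ c)
∑-*ˡ (suc n) c h rewrite ∑-*ˡ n c h = ≡.sym (ℕ.*-distribˡ-+ c (∑ n h) (h n))

∑-*ʳ : ∀ n c (h : ℕ → ℕ) → ∑ n (λ i → h i ℕ.* c) ≡ ∑ n h ℕ.* c
∑-*ʳ n c h = ≡.trans (∑-cong n (λ i → ℕ.*-comm (h i) c)) (≡.trans (∑-*ˡ n c h) (ℕ.*-comm c _))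

∑-≡0 : ∀ n {h : ℕ → ℕ} → (∀ i → i < n → h i ≡ 0) → ∑ n h ≡ 0
∑-≡0 zero    eq = ≡.refl
∑-≡0 (suc n) eq rewrite ∑-≡0 n (λ i i<n → eq i (ℕ.m<n⇒m<1+n i<n)) | eq n ℕ.≤-refl = ≡.refl

∑-const : ∀ n c → ∑ n (λ _ → c) ≡ n ℕ.* c
∑-const zero    c = ≡.refl
∑-const (suc n) c rewrite ∑-const n c = ℕ.+-comm (n ℕ.* c) c

∑-comm : ∀ n m (h : ℕ → ℕ → ℕ) → ∑ n (λ i → ∑ m (h i)) ≡ ∑ m (λ j → ∑ n (λ i → h i j))
∑-comm zero    m h = ≡.sym (∑-≡0 m (λ _ _ → ≡.refl))
∑-comm (suc n) m h rewrite ∑-comm n m h = ≡.sym (∑-distrib-+ m (λ j → ∑ n (λ i → h i j)) (h n))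

∑-single : ∀ n {h : ℕ → ℕ} j → j < n → (∀ i → i < n → i ≢ j → h i ≡ 0) → ∑ n h ≡ h j
∑-single (suc n) {h} j j<1+n others with j ℕ.≟ n
... | yes ≡.refl = ≡.cong (ℕ._+ h n) (∑-≡0 n (λ i i<n → others i (ℕ.m<n⇒m<1+n i<n) (ℕ.<⇒≢ i<n)))
... | no  j≢n    = begin
  ∑ n h ℕ.+ h n ≡⟨ ≡.cong₂ ℕ._+_ (∑-single n j j<n (λ i i<n → others i (ℕ.m<n⇒m<1+n i<n)))
                                  (others n ℕ.≤-refl (j≢n ∘ ≡.sym)) ⟩
  h j ℕ.+ 0     ≡⟨ ℕ.+-identityʳ (h j) ⟩
  h j           ∎
  where
    open ≡-Reasoning
    j<n = ℕ.≤∧≢⇒< (ℕ.≤-pred j<1+n) j≢n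

∑-suc : ∀ n (h : ℕ → ℕ) → ∑ (suc n) h ≡ h 0 ℕ.+ ∑ n (h ∘ suc)
∑-suc zero    h = ≡.sym (ℕ.+-identityʳ (h 0))
∑-suc (suc n) h rewrite ∑-suc n h = ℕ.+-assoc (h 0) _ _

∑-reverse : ∀ n (h : ℕ → ℕ) → ∑ n h ≡ ∑ n (λ i → h (n ℕ.∸ suc i))
∑-reverse zero    h = ≡.refl
∑-reverse (suc n) h = begin
  ∑ n h ℕ.+ h n                                ≡⟨ ≡.cong (ℕ._+ h n) (∑-reverse n h) ⟩
  ∑ n (λ i → h (n ℕ.∸ suc i)) ℕ.+ h n          ≡⟨ ℕ.+-comm _ (h n) ⟩
  h n ℕ.+ ∑ n (λ i → h (suc n ℕ.∸ suc (suc i))) ≡⟨ ∑-suc n (λ i → h (suc n ℕ.∸ suc i)) ⟨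
  ∑ (suc n) (λ i → h (suc n ℕ.∸ suc i))        ∎
  where open ≡-Reasoning

∑-split-+ : ∀ a b (h : ℕ → ℕ) → ∑ (a ℕ.+ b) h ≡ ∑ a h ℕ.+ ∑ b (λ x → h (a ℕ.+ x))
∑-split-+ a zero    h rewrite ℕ.+-identityʳ a = ≡.sym (ℕ.+-identityʳ _)
∑-split-+ a (suc b) h rewrite ℕ.+-suc a b | ∑-split-+ a b h = ℕ.+-assoc (∑ a h) _ _

∑-split-* : ∀ m k (h : ℕ → ℕ) → ∑ (m ℕ.* k) h ≡ ∑ m (λ w → ∑ k (λ v → h (k ℕ.* w ℕ.+ v)))
∑-split-* zero    k h = ≡.refl
∑-split-* (suc m) k h = begin
  ∑ (k ℕ.+ m ℕ.* k) h                                 ≡⟨ ≡.cong (λ z → ∑ z h) (ℕ.+-comm k (m ℕ.* k)) ⟩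
  ∑ (m ℕ.* k ℕ.+ k) h                                 ≡⟨ ∑-split-+ (m ℕ.* k) k h ⟩
  ∑ (m ℕ.* k) h ℕ.+ ∑ k (λ v → h (m ℕ.* k ℕ.+ v))     ≡⟨ ≡.cong₂ ℕ._+_ (∑-split-* m k h)
                                                          (∑-cong k (λ v → ≡.cong (λ z → h (z ℕ.+ v)) (ℕ.*-comm m k))) ⟩
  ∑ m (λ w → ∑ k (λ v → h (k ℕ.* w ℕ.+ v))) ℕ.+ ∑ k (λ v → h (k ℕ.* m ℕ.+ v)) ∎
  where open ≡-Reasoning

∑² : ℕ → (ℕ → ℕ → ℕ) → ℕ
∑² m P = ∑ m (λ a → ∑ m (P a))

∑²-cong : ∀ m {P Q : ℕ → ℕ → ℕ} → (∀ a b → P a b ≡ Q a b) → ∑² m P ≡ ∑² m Q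
∑²-cong m eq = ∑-cong m (λ a → ∑-cong m (eq a))

∑²-distrib-+ : ∀ m (P Q : ℕ → ℕ → ℕ) → ∑² m (λ a b → P a b ℕ.+ Q a b) ≡ ∑² m P ℕ.+ ∑² m Q
∑²-distrib-+ m P Q = ≡.trans (∑-cong m (λ a → ∑-distrib-+ m (P a) (Q a))) (∑-distrib-+ m _ _)

∑²-*ˡ : ∀ m c (P : ℕ → ℕ → ℕ) → ∑² m (λ a b → c ℕ.* P a b) ≡ c ℕ.* ∑² m P
∑²-*ˡ m c P = ≡.trans (∑-cong m (λ a → ∑-*ˡ m c (P a))) (∑-*ˡ m c _)

∑²-*ʳ : ∀ m c (P : ℕ → ℕ → ℕ) → ∑² m (λ a b → P a b ℕ.* c) ≡ ∑² m P ℕ.* c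
∑²-*ʳ m c P = ≡.trans (∑-cong m (λ a → ∑-*ʳ m c (P a))) (∑-*ʳ m c _)

∑²-product : ∀ m m′ (P Q : ℕ → ℕ → ℕ) →
             ∑² m (λ a b → ∑² m′ (λ c d → P a b ℕ.* Q c d)) ≡ ∑² m P ℕ.* ∑² m′ Q
∑²-product m m′ P Q = ≡.trans (∑²-cong m (λ a b → ∑²-*ˡ m′ (P a b) Q)) (∑²-*ʳ m (∑² m′ Q) P)

∑²-comm-∑ : ∀ m m′ (H : ℕ → ℕ → ℕ → ℕ) →
            ∑² m (λ a b → ∑ m′ (H a b)) ≡ ∑ m′ (λ x → ∑² m (λ a b → H a b x))
∑²-comm-∑ m m′ H = ≡.trans (∑-cong m (λ a → ∑-comm m m′ (H a))) (∑-comm m m′ _)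

∑²-comm : ∀ m m′ (H : ℕ → ℕ → ℕ → ℕ → ℕ) →
          ∑² m (λ a b → ∑² m′ (H a b)) ≡ ∑² m′ (λ c d → ∑² m (λ a b → H a b c d))
∑²-comm m m′ H = ≡.trans (∑²-comm-∑ m m′ _) (∑-cong m′ (λ c → ∑²-comm-∑ m m′ (λ a b → H a b c)))

∑²-split-* : ∀ k f (H : ℕ → ℕ → ℕ) →
  ∑² (k ℕ.* f) H ≡ ∑² k (λ v v′ → ∑² f (λ w w′ → H (k ℕ.* w ℕ.+ v) (k ℕ.* w′ ℕ.+ v′)))
∑²-split-* k f H = begin
  ∑² (k ℕ.* f) H                                                            ≡⟨ ≡.cong (λ m → ∑² m H) (ℕ.*-comm k f) ⟩
  ∑ (f ℕ.* k) (λ c → ∑ (f ℕ.* k) (H c))                                     ≡⟨ ∑-split-* f k _ ⟩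
  ∑ f (λ w → ∑ k (λ v → ∑ (f ℕ.* k) (H (k ℕ.* w ℕ.+ v))))                   ≡⟨ ∑-cong f (λ w → ∑-cong k (λ v → ∑-split-* f k _)) ⟩
  ∑ f (λ w → ∑ k (λ v → ∑ f (λ w′ → ∑ k (λ v′ → H′ w v w′ v′))))            ≡⟨ ∑-cong f (λ w → ∑-cong k (λ v → ∑-comm f k _)) ⟩
  ∑ f (λ w → ∑² k (λ v v′ → ∑ f (λ w′ → H′ w v w′ v′)))                     ≡⟨ ∑-comm f k _ ⟩
  ∑ k (λ v → ∑ f (λ w → ∑ k (λ v′ → ∑ f (λ w′ → H′ w v w′ v′))))            ≡⟨ ∑-cong k (λ v → ∑-comm f k _) ⟩
  ∑² k (λ v v′ → ∑² f (λ w w′ → H′ w v w′ v′))                              ∎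
  where
    open ≡-Reasoning
    H′ : ℕ → ℕ → ℕ → ℕ → ℕ
    H′ w v w′ v′ = H (k ℕ.* w ℕ.+ v) (k ℕ.* w′ ℕ.+ v′)

χ-cong : ∀ {a b} {P : Set a} {Q : Set b} → (P → Q) → (Q → P) → (p? : Dec P) (q? : Dec Q) → χ p? ≡ χ q?
χ-cong to from (yes p) (yes q) = ≡.refl
χ-cong to from (yes p) (no ¬q) = ⊥-elim (¬q (to p))
χ-cong to from (no ¬p) (yes q) = ⊥-elim (¬p (from q))
χ-cong to from (no ¬p) (no ¬q) = ≡.refl

χ-yes : ∀ {a} {P : Set a} → P → (p? : Dec P) → χ p? ≡ 1
χ-yes p (yes _) = ≡.refl
χ-yes p (no ¬p) = ⊥-elim (¬p p)

χ-no : ∀ {a} {P : Set a} → ¬ P → (p? : Dec P) → χ p? ≡ 0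
χ-no ¬p (yes p) = ⊥-elim (¬p p)
χ-no ¬p (no _)  = ≡.refl

Periodic : ℕ → (ℤ → ℕ) → Set
Periodic f ψ = ∀ z → ψ (z ℤ.+ + f) ≡ ψ z

∑-shift-ℕ : ∀ f (ψ : ℤ → ℕ) → Periodic f ψ → ∀ s → ∑ f (λ u → ψ (+ u ℤ.+ + s)) ≡ ∑ f (ψ ∘ +_)
∑-shift-ℕ f ψ per zero    = ∑-cong f (λ u → ≡.cong ψ (ℤ.+-identityʳ (+ u)))
∑-shift-ℕ f ψ per (suc s) = begin
  ∑ f (λ u → ψ (+ u ℤ.+ + suc s))  ≡⟨ ∑-cong f (λ u → ≡.cong ψ (+u++1+s u)) ⟩
  ∑ f (φ ∘ suc)                     ≡⟨ ℕ.+-cancelˡ-≡ (φ 0) _ _ rotate ⟩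
  ∑ f φ                             ≡⟨ ∑-shift-ℕ f ψ per s ⟩
  ∑ f (ψ ∘ +_)                      ∎
  where
    open ≡-Reasoning
    φ : ℕ → ℕ
    φ u = ψ (+ u ℤ.+ + s)
    +u++1+s : ∀ u → + u ℤ.+ + suc s ≡ + suc u ℤ.+ + s
    +u++1+s u = ≡.cong +_ (ℕ.+-suc u s)
    φf≡φ0 : φ f ≡ φ 0
    φf≡φ0 = ≡.trans (≡.cong ψ (ℤ.+-comm (+ f) (+ s))) (per (+ s))
    rotate : φ 0 ℕ.+ ∑ f (φ ∘ suc) ≡ φ 0 ℕ.+ ∑ f φ
    rotate = begin
      φ 0 ℕ.+ ∑ f (φ ∘ suc) ≡⟨ ∑-suc f φ ⟨
      ∑ f φ ℕ.+ φ f         ≡⟨ ≡.cong (∑ f φ ℕ.+_) φf≡φ0 ⟩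
      ∑ f φ ℕ.+ φ 0         ≡⟨ ℕ.+-comm (∑ f φ) (φ 0) ⟩
      φ 0 ℕ.+ ∑ f φ         ∎

∑-shift : ∀ f (ψ : ℤ → ℕ) → Periodic f ψ → ∀ t → ∑ f (λ u → ψ (+ u ℤ.+ t)) ≡ ∑ f (ψ ∘ +_)
∑-shift f ψ per (+ s)      = ∑-shift-ℕ f ψ per s
∑-shift f ψ per -[1+ s ] = ≡.sym (begin
  ∑ f (ψ ∘ +_)                         ≡⟨ ∑-cong f (λ u → ≡.cong ψ (cancel (+ u) (+ suc s))) ⟨
  ∑ f (λ u → ψ′ (+ u ℤ.+ + suc s))      ≡⟨ ∑-shift-ℕ f ψ′ per′ (suc s) ⟩
  ∑ f (ψ′ ∘ +_)                        ∎)
  where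
    open ≡-Reasoning
    ψ′ : ℤ → ℕ
    ψ′ z = ψ (z ℤ.+ -[1+ s ])
    cancel : ∀ a b → a ℤ.+ b ℤ.- b ≡ a
    cancel = ℤ-Solver.solve-∀
    commute : ∀ z t → z ℤ.+ t ℤ.+ -[1+ s ] ≡ z ℤ.+ -[1+ s ] ℤ.+ t
    commute = ℤ-Solver.solve-∀
    per′ : Periodic f ψ′
    per′ z = ≡.trans (≡.cong ψ (commute z (+ f))) (per _)

∑-negate : ∀ f (ψ : ℤ → ℕ) → Periodic f ψ → ∑ f (λ u → ψ (ℤ.- + u)) ≡ ∑ f (ψ ∘ +_)
∑-negate f ψ per = begin
  ∑ f (λ u → ψ (ℤ.- + u))                 ≡⟨ ∑-reverse f _ ⟩
  ∑ f (λ u → ψ (ℤ.- + (f ℕ.∸ suc u)))     ≡⟨ ∑-cong-< f reflect ⟩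
  ∑ f (λ u → ψ (+ u ℤ.+ (+ 1 ℤ.- + f)))   ≡⟨ ∑-shift f ψ per (+ 1 ℤ.- + f) ⟩
  ∑ f (ψ ∘ +_)                            ∎
  where
    open ≡-Reasoning
    negate : ∀ u r → ℤ.- r ≡ u ℤ.+ (+ 1 ℤ.- (+ 1 ℤ.+ u ℤ.+ r))
    negate = ℤ-Solver.solve-∀
    reflect : ∀ u → u < f → ψ (ℤ.- + (f ℕ.∸ suc u)) ≡ ψ (+ u ℤ.+ (+ 1 ℤ.- + f))
    reflect u u<f = ≡.cong ψ (≡.trans (negate (+ u) (+ (f ℕ.∸ suc u)))
      (≡.cong (λ w → + u ℤ.+ (+ 1 ℤ.- + w)) (ℕ.m+[n∸m]≡n u<f)))

module FieldProperties {c ℓ} (F : DecField c ℓ) where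
  open DecField F
  open import Algebra.Definitions _≈_ using (AlmostLeftCancellative)
  open import Algebra.Properties.CommutativeSemigroup *-commutativeSemigroup using (interchange)
  open import Relation.Binary.Reasoning.Setoid setoid

  ⁻¹-inverseˡ : ∀ x → ¬ x ≈ 0# → x ⁻¹ * x ≈ 1#
  ⁻¹-inverseˡ x x≉0 = trans (*-comm _ _) (inverseʳ x x≉0)

  ⁻¹-cancelˡ : ∀ x → ¬ x ≈ 0# → ∀ a → x ⁻¹ * (x * a) ≈ a
  ⁻¹-cancelˡ x x≉0 a = begin
    x ⁻¹ * (x * a) ≈⟨ *-assoc _ _ _ ⟨
    x ⁻¹ * x * a   ≈⟨ *-congʳ (⁻¹-inverseˡ x x≉0) ⟩
    1# * a         ≈⟨ *-identityˡ a ⟩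
    a              ∎

  *-cancelˡ-≉0 : AlmostLeftCancellative 0# _*_
  *-cancelˡ-≉0 x a b x≉0 xa≈xb = begin
    a              ≈⟨ ⁻¹-cancelˡ x x≉0 a ⟨
    x ⁻¹ * (x * a) ≈⟨ *-congˡ xa≈xb ⟩
    x ⁻¹ * (x * b) ≈⟨ ⁻¹-cancelˡ x x≉0 b ⟩
    b              ∎

  *-≉0 : ∀ {x y} → ¬ x ≈ 0# → ¬ y ≈ 0# → ¬ x * y ≈ 0#
  *-≉0 {x} {y} x≉0 y≉0 xy≈0 = y≉0 (*-cancelˡ-≉0 x y 0# x≉0 (trans xy≈0 (sym (zeroʳ x))))

  +-cancelˡ : ∀ x y z → x + y ≈ x + z → y ≈ z
  +-cancelˡ = ∙-cancelˡ
    where open import Algebra.Properties.Group +-group using (∙-cancelˡ)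

  x+xy≈x[1+y] : ∀ x y → x + x * y ≈ x * (1# + y)
  x+xy≈x[1+y] x y = begin
    x + x * y      ≈⟨ +-congʳ (*-identityʳ x) ⟨
    x * 1# + x * y ≈⟨ distribˡ x 1# y ⟨
    x * (1# + y)   ∎

  x+xy≈xz⇒1+y≈z : ∀ {x y z} → ¬ x ≈ 0# → x + x * y ≈ x * z → 1# + y ≈ z
  x+xy≈xz⇒1+y≈z {x} {y} {z} x≉0 eq = *-cancelˡ-≉0 x _ _ x≉0 (trans (sym (x+xy≈x[1+y] x y)) eq)

  1+y≈z⇒x+xy≈xz : ∀ {x y z} → 1# + y ≈ z → x + x * y ≈ x * z
  1+y≈z⇒x+xy≈xz {x} {y} eq = trans (x+xy≈x[1+y] x y) (*-congˡ eq)

  x*x≈1⇒1+x≈0 : ∀ x → x * x ≈ 1# → ¬ x ≈ 1# → 1# + x ≈ 0#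
  x*x≈1⇒1+x≈0 x x²≈1 x≉1 with (1# + x) ≟ 0#
  ... | yes 1+x≈0 = 1+x≈0
  ... | no  1+x≉0 = ⊥-elim (x≉1 (*-cancelˡ-≉0 (1# + x) x 1# 1+x≉0 (begin
    (1# + x) * x   ≈⟨ distribʳ x 1# x ⟩
    1# * x + x * x ≈⟨ +-cong (*-identityˡ x) x²≈1 ⟩
    x + 1#         ≈⟨ +-comm x 1# ⟩
    1# + x         ≈⟨ *-identityʳ _ ⟨
    (1# + x) * 1#  ∎)))

  pow-≉0 : ∀ {x} → ¬ x ≈ 0# → ∀ a → ¬ pow F x a ≈ 0#
  pow-≉0 x≉0 zero    1≈0 = 0≉1 (sym 1≈0)
  pow-≉0 x≉0 (suc a)     = *-≉0 x≉0 (pow-≉0 x≉0 a)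

  pow-+ : ∀ x a b → pow F x (a ℕ.+ b) ≈ pow F x a * pow F x b
  pow-+ x zero    b = sym (*-identityˡ _)
  pow-+ x (suc a) b = trans (*-congˡ (pow-+ x a b)) (sym (*-assoc _ _ _))

  pow-* : ∀ x {d} → pow F x d ≈ 1# → ∀ q → pow F x (q ℕ.* d) ≈ 1#
  pow-* x xᵈ≈1 zero    = refl
  pow-* x {d} xᵈ≈1 (suc q) = begin
    pow F x (d ℕ.+ q ℕ.* d)        ≈⟨ pow-+ x d (q ℕ.* d) ⟩
    pow F x d * pow F x (q ℕ.* d)  ≈⟨ *-cong xᵈ≈1 (pow-* x xᵈ≈1 q) ⟩
    1# * 1#                        ≈⟨ *-identityˡ 1# ⟩
    1#                             ∎

  pow⁻¹*pow≈1 : ∀ x → ¬ x ≈ 0# → ∀ j → pow F (x ⁻¹) j * pow F x j ≈ 1#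
  pow⁻¹*pow≈1 x x≉0 zero    = *-identityˡ 1#
  pow⁻¹*pow≈1 x x≉0 (suc j) = begin
    (x ⁻¹ * pow F (x ⁻¹) j) * (x * pow F x j) ≈⟨ interchange _ _ _ _ ⟩
    (x ⁻¹ * x) * (pow F (x ⁻¹) j * pow F x j) ≈⟨ *-cong (⁻¹-inverseˡ x x≉0) (pow⁻¹*pow≈1 x x≉0 j) ⟩
    1# * 1#                                   ≈⟨ *-identityˡ 1# ⟩
    1#                                        ∎

module GeneratorOrder {c ℓ} (F : DecField c ℓ) (g : DecField.Carrier F) (n : ℕ)
                      (size : HasSize F (suc n)) (gen : IsGenerator F g) where
  open DecField F
  open FieldProperties F
  open import Relation.Binary.Reasoning.Setoid setoid

  g^_ : ℕ → Carrier
  g^_ = pow F g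

  g≉0 : ¬ g ≈ 0#
  g≉0 = proj₁ gen

  g^-≉0 : ∀ a → ¬ g^ a ≈ 0#
  g^-≉0 = pow-≉0 g≉0

  g^-+ : ∀ a b → g^ (a ℕ.+ b) ≈ g^ a * g^ b
  g^-+ = pow-+ g

  log : ∀ x → ¬ x ≈ 0# → ℕ
  log x x≉0 = proj₁ (proj₂ gen x x≉0)

  g^log : ∀ x x≉0 → g^ log x x≉0 ≈ x
  g^log x x≉0 = proj₂ (proj₂ gen x x≉0)

  private
    enum : Fin (suc n) → Carrier
    enum = proj₁ size

    enum-injective : ∀ a b → enum a ≈ enum b → a ≡ b
    enum-injective = proj₁ (proj₂ size)

    enum-surjective : ∀ x → ∃ λ a → enum a ≈ x
    enum-surjective = proj₂ (proj₂ size)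

    index-of-0 : Fin (suc n)
    index-of-0 = proj₁ (enum-surjective 0#)

    enum-index-of-0 : enum index-of-0 ≈ 0#
    enum-index-of-0 = proj₂ (enum-surjective 0#)

    nonzero : Fin n → Carrier
    nonzero i = enum (punchIn index-of-0 i)

    nonzero-≉0 : ∀ i → ¬ nonzero i ≈ 0#
    nonzero-≉0 i eq = Fin.punchInᵢ≢i index-of-0 i
      (enum-injective _ _ (trans eq (sym enum-index-of-0)))

    nonzero-injective : ∀ i j → nonzero i ≈ nonzero j → i ≡ j
    nonzero-injective i j eq = Fin.punchIn-injective index-of-0 i j (enum-injective _ _ eq)

    nonzero-surjective : ∀ x → ¬ x ≈ 0# → ∃ λ i → nonzero i ≈ x
    nonzero-surjective x x≉0 with enum-surjective x
    ... | a , ea≈x = punchOut 0≢a , trans (reflexive (≡.cong enum (Fin.punchIn-punchOut 0≢a))) ea≈x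
      where
        0≢a : index-of-0 ≢ a
        0≢a ≡.refl = x≉0 (trans (sym ea≈x) enum-index-of-0)

  g^-split : ∀ {a b} → a ≤ b → g^ b ≈ g^ a * g^ (b ℕ.∸ a)
  g^-split {a} {b} a≤b = trans (reflexive (≡.cong g^_ (≡.sym (ℕ.m+[n∸m]≡n a≤b)))) (g^-+ a (b ℕ.∸ a))

  g^a≈g^b⇒g^[b∸a]≈1 : ∀ {a b} → a ≤ b → g^ a ≈ g^ b → g^ (b ℕ.∸ a) ≈ 1#
  g^a≈g^b⇒g^[b∸a]≈1 {a} {b} a≤b eq =
    sym (*-cancelˡ-≉0 (g^ a) _ _ (g^-≉0 a) (trans (*-identityʳ _) (trans eq (g^-split a≤b))))

  g^-% : ∀ {d} .{{_ : NonZero d}} → g^ d ≈ 1# → ∀ N → g^ N ≈ g^ (N % d)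
  g^-% {d} gᵈ≈1 N = begin
    g^ N                           ≈⟨ reflexive (≡.cong g^_ (m≡m%n+[m/n]*n N d)) ⟩
    g^ (N % d ℕ.+ N / d ℕ.* d)     ≈⟨ g^-+ (N % d) (N / d ℕ.* d) ⟩
    g^ (N % d) * g^ (N / d ℕ.* d)  ≈⟨ *-congˡ (pow-* g gᵈ≈1 (N / d)) ⟩
    g^ (N % d) * 1#                ≈⟨ *-identityʳ _ ⟩
    g^ (N % d)                     ∎

  -- If g^d = 1, then every nonzero element is g^r with r < d, so there are at most d of them.
  g^d≈1⇒n≤d : ∀ {d} → 0 < d → g^ d ≈ 1# → n ≤ d
  g^d≈1⇒n≤d {d} 0<d gᵈ≈1 = Fin.injective⇒≤ {f = residue} residue-injective
    where
      instance _ = ℕ.>-nonZero 0<d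
      exponent : Fin n → ℕ
      exponent i = log (nonzero i) (nonzero-≉0 i)
      residue : Fin n → Fin d
      residue i = fromℕ< (m%n<n (exponent i) d)
      residue-injective : ∀ {i j} → residue i ≡ residue j → i ≡ j
      residue-injective {i} {j} eq = nonzero-injective i j (begin
        nonzero i            ≈⟨ g^log _ _ ⟨
        g^ exponent i        ≈⟨ g^-% gᵈ≈1 (exponent i) ⟩
        g^ (exponent i % d)  ≡⟨ ≡.cong g^_ (Fin.fromℕ<-injective _ _ _ _ eq) ⟩
        g^ (exponent j % d)  ≈⟨ g^-% gᵈ≈1 (exponent j) ⟨
        g^ exponent j        ≈⟨ g^log _ _ ⟩
        nonzero j            ∎)

  private
    position : Fin (suc n) → Fin n
    position i = proj₁ (nonzero-surjective (g^ toℕ i) (g^-≉0 (toℕ i)))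

    nonzero-position : ∀ i → nonzero (position i) ≈ g^ toℕ i
    nonzero-position i = proj₂ (nonzero-surjective (g^ toℕ i) (g^-≉0 (toℕ i)))

  -- Pigeonhole: the n + 1 powers g^0, …, g^n lie among the n nonzero elements.
  ∃g^d≈1 : ∃ λ d → 0 < d × d ≤ n × g^ d ≈ 1#
  ∃g^d≈1 with Fin.pigeonhole (ℕ.n<1+n n) position
  ... | i , j , i<j , eq = toℕ j ℕ.∸ toℕ i , ℕ.m<n⇒0<n∸m i<j
      , ℕ.≤-trans (ℕ.m∸n≤m (toℕ j) (toℕ i)) (ℕ.≤-pred (Fin.toℕ<n j))
      , g^a≈g^b⇒g^[b∸a]≈1 (ℕ.<⇒≤ i<j) (begin
          g^ toℕ i             ≈⟨ nonzero-position i ⟨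
          nonzero (position i) ≡⟨ ≡.cong nonzero eq ⟩
          nonzero (position j) ≈⟨ nonzero-position j ⟩
          g^ toℕ j             ∎)

  g^n≈1 : g^ n ≈ 1#
  g^n≈1 with ∃g^d≈1
  ... | d , 0<d , d≤n , gᵈ≈1 =
    trans (reflexive (≡.cong g^_ (ℕ.≤-antisym (g^d≈1⇒n≤d 0<d gᵈ≈1) d≤n))) gᵈ≈1

  n∣⇒g^≈1 : ∀ {a} → n ∣ a → g^ a ≈ 1#
  n∣⇒g^≈1 (ℕ∣.divides q ≡.refl) = pow-* g g^n≈1 q

  n∣∸⇒g^≈g^ : ∀ {a b} → b ≤ a → n ∣ a ℕ.∸ b → g^ a ≈ g^ b
  n∣∸⇒g^≈g^ {a} {b} b≤a n∣a∸b = trans (g^-split b≤a) (trans (*-congˡ (n∣⇒g^≈1 n∣a∸b)) (*-identityʳ _))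

  g^-distinct : ∀ {a b} → a < b → b < n → ¬ g^ a ≈ g^ b
  g^-distinct {a} {b} a<b b<n eq = ℕ.<⇒≱ b<n (ℕ.≤-trans n≤b∸a (ℕ.m∸n≤m b a))
    where
      n≤b∸a : n ≤ b ℕ.∸ a
      n≤b∸a = g^d≈1⇒n≤d (ℕ.m<n⇒0<n∸m a<b) (g^a≈g^b⇒g^[b∸a]≈1 (ℕ.<⇒≤ a<b) eq)

  g^-injective : ∀ {a b} → a < n → b < n → g^ a ≈ g^ b → a ≡ b
  g^-injective {a} {b} a<n b<n eq with ℕ.<-cmp a b
  ... | tri< a<b _ _ = ⊥-elim (g^-distinct a<b b<n eq)
  ... | tri≈ _ a≡b _ = a≡b
  ... | tri> _ _ b<a = ⊥-elim (g^-distinct b<a a<n (sym eq))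

module IntegerPowers {c ℓ} (F : DecField c ℓ) (g : DecField.Carrier F) (n : ℕ)
                     (size : HasSize F (suc n)) (gen : IsGenerator F g) .{{_ : NonZero n}} where
  open DecField F
  open FieldProperties F
  open GeneratorOrder F g n size gen public
  open import Relation.Binary.Reasoning.Setoid setoid

  g^ℤ_ : ℤ → Carrier
  g^ℤ_ = powℤ F g

  g^ℤ≈g^ : ∀ z N → + n ∣ℤ z ℤ.- + N → g^ℤ z ≈ g^ N
  g^ℤ≈g^ (+ m) N n∣m-N with ℕ.≤-total m N
  ... | inj₁ m≤N = sym (n∣∸⇒g^≈g^ m≤N (≡.subst (n ∣_) ∣m-N∣≡N∸m (∣⇒∣ᵤ n∣m-N)))
    where
      ∣m-N∣≡N∸m : ∣ + m ℤ.- + N ∣ ≡ N ℕ.∸ m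
      ∣m-N∣≡N∸m = ≡.trans (≡.cong ∣_∣ (ℤ.m-n≡m⊖n m N)) (ℤ.∣⊖∣-≤ m≤N)
  ... | inj₂ N≤m = n∣∸⇒g^≈g^ N≤m (≡.subst (n ∣_) ∣m-N∣≡m∸N (∣⇒∣ᵤ n∣m-N))
    where
      ∣m-N∣≡m∸N : ∣ + m ℤ.- + N ∣ ≡ m ℕ.∸ N
      ∣m-N∣≡m∸N = ≡.trans (≡.cong ∣_∣ (ℤ.m-n≡m⊖n m N)) (≡.trans (ℤ.∣m⊖n∣≡∣n⊖m∣ m N) (ℤ.∣⊖∣-≤ N≤m))
  g^ℤ≈g^ -[1+ m ] N n∣z-N = begin
    g⁻ᵐ                    ≈⟨ *-identityʳ g⁻ᵐ ⟨
    g⁻ᵐ * 1#               ≈⟨ *-congˡ (n∣⇒g^≈1 (≡.subst (n ∣_) (∣-[1+m]-N∣ m N) (∣⇒∣ᵤ n∣z-N))) ⟨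
    g⁻ᵐ * g^ (suc m ℕ.+ N) ≈⟨ *-congˡ (g^-+ (suc m) N) ⟩
    g⁻ᵐ * (g^ suc m * g^ N) ≈⟨ *-assoc _ _ _ ⟨
    g⁻ᵐ * g^ suc m * g^ N  ≈⟨ *-congʳ (pow⁻¹*pow≈1 g g≉0 (suc m)) ⟩
    1# * g^ N              ≈⟨ *-identityˡ _ ⟩
    g^ N                   ∎
    where
      g⁻ᵐ = pow F (g ⁻¹) (suc m)
      ∣-[1+m]-N∣ : ∀ m N → ∣ -[1+ m ] ℤ.- + N ∣ ≡ suc m ℕ.+ N
      ∣-[1+m]-N∣ m zero    = ≡.cong suc (≡.sym (ℕ.+-identityʳ m))
      ∣-[1+m]-N∣ m (suc N) = ≡.cong suc (≡.sym (ℕ.+-suc m N))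

  ∃-residue : ∀ z → ∃ λ N → N < n × + n ∣ℤ z ℤ.- + N
  ∃-residue z = r , ℤ.n%ℕd<d z n , divides (z ℤ./ℕ n)
    (≡.trans (≡.cong (ℤ._- + r) (ℤ.a≡a%ℕn+[a/ℕn]*n z n)) (cancel (+ r) (z ℤ./ℕ n ℤ.* + n)))
    where
      r = z ℤ.%ℕ n
      cancel : ∀ a b → a ℤ.+ b ℤ.- a ≡ b
      cancel = ℤ-Solver.solve-∀

  g^ℤ-cong : ∀ {a b} → + n ∣ℤ a ℤ.- b → g^ℤ a ≈ g^ℤ b
  g^ℤ-cong {a} {b} n∣a-b with ∃-residue b
  ... | N , _ , n∣b-N = trans (g^ℤ≈g^ a N (≡.subst (+ n ∣ℤ_) (telescope a b (+ N)) (ℤ∣.∣m∣n⇒∣m+n n∣a-b n∣b-N)))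
                              (sym (g^ℤ≈g^ b N n∣b-N))
    where
      telescope : ∀ a b c → a ℤ.- b ℤ.+ (b ℤ.- c) ≡ a ℤ.- c
      telescope = ℤ-Solver.solve-∀

  g^ℤ-+ : ∀ a b → g^ℤ (a ℤ.+ b) ≈ g^ℤ a * g^ℤ b
  g^ℤ-+ a b with ∃-residue a | ∃-residue b
  ... | Nᵃ , _ , n∣a-Nᵃ | Nᵇ , _ , n∣b-Nᵇ = begin
    g^ℤ (a ℤ.+ b)   ≈⟨ g^ℤ≈g^ (a ℤ.+ b) (Nᵃ ℕ.+ Nᵇ) n∣a+b-[Nᵃ+Nᵇ] ⟩
    g^ (Nᵃ ℕ.+ Nᵇ)  ≈⟨ g^-+ Nᵃ Nᵇ ⟩
    g^ Nᵃ * g^ Nᵇ   ≈⟨ *-cong (g^ℤ≈g^ a Nᵃ n∣a-Nᵃ) (g^ℤ≈g^ b Nᵇ n∣b-Nᵇ) ⟨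
    g^ℤ a * g^ℤ b   ∎
    where
      regroup : ∀ a b x y → a ℤ.- x ℤ.+ (b ℤ.- y) ≡ a ℤ.+ b ℤ.- (x ℤ.+ y)
      regroup = ℤ-Solver.solve-∀
      n∣a+b-[Nᵃ+Nᵇ] : + n ∣ℤ a ℤ.+ b ℤ.- + (Nᵃ ℕ.+ Nᵇ)
      n∣a+b-[Nᵃ+Nᵇ] = ≡.subst (+ n ∣ℤ_) (regroup a b (+ Nᵃ) (+ Nᵇ)) (ℤ∣.∣m∣n⇒∣m+n n∣a-Nᵃ n∣b-Nᵇ)

  g^ℤ-injective : ∀ {a b} → g^ℤ a ≈ g^ℤ b → + n ∣ℤ a ℤ.- b
  g^ℤ-injective {a} {b} eq with ∃-residue a | ∃-residue b
  ... | Nᵃ , Nᵃ<n , n∣a-Nᵃ | Nᵇ , Nᵇ<n , n∣b-Nᵇ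
    with g^-injective Nᵃ<n Nᵇ<n (trans (sym (g^ℤ≈g^ a Nᵃ n∣a-Nᵃ)) (trans eq (g^ℤ≈g^ b Nᵇ n∣b-Nᵇ)))
  ... | ≡.refl = ≡.subst (+ n ∣ℤ_) (telescope a b (+ Nᵃ)) (ℤ∣.∣m∣n⇒∣m-n n∣a-Nᵃ n∣b-Nᵇ)
    where
      telescope : ∀ a b c → a ℤ.- c ℤ.- (b ℤ.- c) ≡ a ℤ.- b
      telescope = ℤ-Solver.solve-∀

  g^ℤ-≉0 : ∀ a → ¬ g^ℤ a ≈ 0#
  g^ℤ-≉0 a eq with ∃-residue a
  ... | N , _ , n∣a-N = g^-≉0 N (trans (sym (g^ℤ≈g^ a N n∣a-N)) eq)

  g^ℤ-surjective : ∀ x → ¬ x ≈ 0# → ∃ λ c → c < n × x ≈ g^ℤ (+ c)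
  g^ℤ-surjective x x≉0 = log x x≉0 % n , m%n<n _ n , trans (sym (g^log x x≉0)) (g^-% g^n≈1 _)

  module HalfOrder (h : ℕ) (h+h≡n : h ℕ.+ h ≡ n) where
    -- g^h is a square root of 1 other than 1, hence equals −1.
    1+g^h≈0 : 1# + g^ h ≈ 0#
    1+g^h≈0 = x*x≈1⇒1+x≈0 (g^ h) g^h*g^h≈1 g^h≉1
      where
        g^h*g^h≈1 : g^ h * g^ h ≈ 1#
        g^h*g^h≈1 = trans (sym (g^-+ h h)) (trans (reflexive (≡.cong g^_ h+h≡n)) g^n≈1)
        h≢0 : h ≢ 0
        h≢0 ≡.refl = ℕ.≢-nonZero⁻¹ n (≡.sym h+h≡n)
        h<n : h < n
        h<n = ≡.subst (h <_) h+h≡n (ℕ.m<m+n h (ℕ.n≢0⇒n>0 h≢0))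
        g^h≉1 : ¬ g^ h ≈ 1#
        g^h≉1 g^h≈1 = h≢0 (g^-injective h<n (ℕ.>-nonZero⁻¹ n) g^h≈1)

    1+g^ℤ≈0⇒n∣-h : ∀ w → 1# + g^ℤ w ≈ 0# → + n ∣ℤ w ℤ.- + h
    1+g^ℤ≈0⇒n∣-h w eq = g^ℤ-injective {w} {+ h} (+-cancelˡ 1# _ _ (trans eq (sym 1+g^h≈0)))

    n∣-h⇒1+g^ℤ≈0 : ∀ w → + n ∣ℤ w ℤ.- + h → 1# + g^ℤ w ≈ 0#
    n∣-h⇒1+g^ℤ≈0 w n∣w-h = trans (+-congˡ (g^ℤ-cong {w} {+ h} n∣w-h)) 1+g^h≈0

module CosetCounting {c ℓ} (F : DecField c ℓ) (g : DecField.Carrier F) (k f : ℕ)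
                     .{{_ : NonZero k}} .{{_ : NonZero f}}
                     (size : HasSize F (suc (k ℕ.* f))) (gen : IsGenerator F g) where
  open DecField F
  open FieldProperties F

  n : ℕ
  n = k ℕ.* f

  instance
    n≢0 : NonZero n
    n≢0 = ℕ.m*n≢0 k f

  open IntegerPowers F g n size gen public

  ku+ : ℕ → ℤ → ℤ
  ku+ u i = + k ℤ.* + u ℤ.+ i

  [_≈_] : Carrier → Carrier → ℕ
  [ x ≈ y ] = χ (x ≟ y)

  [≈]-yes : ∀ {x y} → x ≈ y → [ x ≈ y ] ≡ 1
  [≈]-yes {x} {y} x≈y = χ-yes x≈y (x ≟ y)

  [≈]-no : ∀ {x y} → ¬ x ≈ y → [ x ≈ y ] ≡ 0
  [≈]-no {x} {y} x≉y = χ-no x≉y (x ≟ y)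

  [≈]-congˡ : ∀ {x y} z → x ≈ y → [ x ≈ z ] ≡ [ y ≈ z ]
  [≈]-congˡ z x≈y = χ-cong (trans (sym x≈y)) (trans x≈y) _ _

  [≈]-congʳ : ∀ {x y} z → x ≈ y → [ z ≈ x ] ≡ [ z ≈ y ]
  [≈]-congʳ z x≈y = χ-cong (λ e → trans e x≈y) (λ e → trans e (sym x≈y)) _ _

  +n≡+k*+f : + n ≡ + k ℤ.* + f
  +n≡+k*+f = ℤ.pos-* k f

  k∣n : + k ∣ℤ + n
  k∣n = divides (+ f) (≡.trans +n≡+k*+f (ℤ.*-comm (+ k) (+ f)))

  k∣k* : ∀ z → + k ∣ℤ + k ℤ.* z
  k∣k* z = divides z (ℤ.*-comm (+ k) z)

  g^ℤ-periodic : ∀ z i → g^ℤ (+ k ℤ.* (z ℤ.+ + f) ℤ.+ i) ≈ g^ℤ (+ k ℤ.* z ℤ.+ i)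
  g^ℤ-periodic z i = g^ℤ-cong {+ k ℤ.* (z ℤ.+ + f) ℤ.+ i} (divides (+ 1) (≡.trans (difference (+ k) z (+ f) i) (≡.cong (+ 1 ℤ.*_) (≡.sym +n≡+k*+f))))
    where
      difference : ∀ k z f i → k ℤ.* (z ℤ.+ f) ℤ.+ i ℤ.- (k ℤ.* z ℤ.+ i) ≡ + 1 ℤ.* (k ℤ.* f)
      difference = ℤ-Solver.solve-∀

  ∑-coset-invariant : (φ : Carrier → ℕ) → (∀ {x y} → x ≈ y → φ x ≡ φ y) →
    ∀ a b → + k ∣ℤ b ℤ.- a → ∑ f (λ u → φ (g^ℤ ku+ u a)) ≡ ∑ f (λ u → φ (g^ℤ ku+ u b))
  ∑-coset-invariant φ φ-cong a b (divides t b-a≡t*k) = ≡.sym (begin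
    ∑ f (λ u → φ (g^ℤ ku+ u b))   ≡⟨ ∑-cong f (λ u → ≡.cong (φ ∘ g^ℤ_) (rewrite-b u)) ⟩
    ∑ f (λ u → ψ (+ u ℤ.+ t))     ≡⟨ ∑-shift f ψ ψ-periodic t ⟩
    ∑ f (ψ ∘ +_)                  ∎)
    where
      ψ : ℤ → ℕ
      ψ z = φ (g^ℤ (+ k ℤ.* z ℤ.+ a))
      ψ-periodic : Periodic f ψ
      ψ-periodic z = φ-cong (g^ℤ-periodic z a)
      open ≡-Reasoning
      rewrite-b : ∀ u → ku+ u b ≡ + k ℤ.* (+ u ℤ.+ t) ℤ.+ a
      rewrite-b u = begin
        + k ℤ.* + u ℤ.+ b                ≡⟨ ≡.cong (ku+ u) (b≡b-a+a a b) ⟩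
        + k ℤ.* + u ℤ.+ (b ℤ.- a ℤ.+ a)  ≡⟨ ≡.cong (λ w → + k ℤ.* + u ℤ.+ (w ℤ.+ a)) b-a≡t*k ⟩
        + k ℤ.* + u ℤ.+ (t ℤ.* + k ℤ.+ a) ≡⟨ distribute (+ k) (+ u) t a ⟨
        + k ℤ.* (+ u ℤ.+ t) ℤ.+ a        ∎
        where
          b≡b-a+a : ∀ a b → b ≡ b ℤ.- a ℤ.+ a
          b≡b-a+a = ℤ-Solver.solve-∀
          distribute : ∀ k u t a → k ℤ.* (u ℤ.+ t) ℤ.+ a ≡ k ℤ.* u ℤ.+ (t ℤ.* k ℤ.+ a)
          distribute = ℤ-Solver.solve-∀

  cyc-cong : ∀ x {y y′} → + k ∣ℤ y′ ℤ.- y → cyc F g k f x y ≡ cyc F g k f x y′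
  cyc-cong x {y} {y′} k∣y′-y =
    ∑-cong f (λ u → ∑-coset-invariant (λ z → [ 1# + g^ℤ ku+ u x ≈ z ]) ([≈]-congʳ _) y y′ k∣y′-y)

  n∤k*u : ∀ {u} → 0 < u → u < f → ¬ (+ n ∣ℤ + k ℤ.* + u)
  n∤k*u {u} 0<u u<f n∣ku = ℕ.<⇒≱ u<f (ℕ∣.∣⇒≤ {{ℕ.>-nonZero 0<u}} f∣u)
    where
      f∣u : f ∣ u
      f∣u = ℕ∣.*-cancelˡ-∣ k (≡.subst (n ∣_) (≡.cong ∣_∣ (≡.sym (ℤ.pos-* k u))) (∣⇒∣ᵤ n∣ku))

  ∑-multiples : ∀ α → ∑ f (λ u → χ (+ n ∣ℤ? ku+ u α)) ≡ χ (+ k ∣ℤ? α)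
  ∑-multiples α with + k ∣ℤ? α
  ... | no k∤α = ∑-≡0 f (λ u _ → χ-no (λ n∣ → k∤α (ℤ∣.∣m+n∣m⇒∣n (ℤ∣.∣-trans k∣n n∣) (k∣k* (+ u)))) _)
  ... | yes (divides t α≡t*k) = begin
    ∑ f (λ u → χ (+ n ∣ℤ? ku+ u α))   ≡⟨ ∑-cong f (λ u → ≡.cong (χ ∘ (+ n ∣ℤ?_)) (ku+α≡k[u+t] u)) ⟩
    ∑ f (λ u → ψ (+ u ℤ.+ t))          ≡⟨ ∑-shift f ψ ψ-periodic t ⟩
    ∑ f (ψ ∘ +_)                       ≡⟨ ∑-single f 0 (ℕ.>-nonZero⁻¹ f) (λ u u<f u≢0 → χ-no (n∤k*u (ℕ.n≢0⇒n>0 u≢0) u<f) _) ⟩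
    ψ (+ 0)                            ≡⟨ χ-yes (divides (+ 0) (ℤ.*-zeroʳ (+ k))) _ ⟩
    1                                  ∎
    where
      open ≡-Reasoning
      ψ : ℤ → ℕ
      ψ z = χ (+ n ∣ℤ? + k ℤ.* z)
      expand : ∀ k z f → k ℤ.* (z ℤ.+ f) ≡ k ℤ.* z ℤ.+ k ℤ.* f
      expand = ℤ-Solver.solve-∀
      k[z+f]≡kz+n : ∀ z → + k ℤ.* (z ℤ.+ + f) ≡ + k ℤ.* z ℤ.+ + n
      k[z+f]≡kz+n z = ≡.trans (expand (+ k) z (+ f)) (≡.cong (λ w → + k ℤ.* z ℤ.+ w) (≡.sym +n≡+k*+f))
      ψ-periodic : Periodic f ψ
      ψ-periodic z rewrite k[z+f]≡kz+n z =
        χ-cong (λ n∣ → ℤ∣.∣m+n∣n⇒∣m n∣ ℤ∣.∣-refl) (λ n∣ → ℤ∣.∣m∣n⇒∣m+n n∣ ℤ∣.∣-refl) _ _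
      distribute : ∀ k u t → k ℤ.* u ℤ.+ t ℤ.* k ≡ k ℤ.* (u ℤ.+ t)
      distribute = ℤ-Solver.solve-∀
      ku+α≡k[u+t] : ∀ u → ku+ u α ≡ + k ℤ.* (+ u ℤ.+ t)
      ku+α≡k[u+t] u = ≡.trans (≡.cong (ku+ u) α≡t*k) (distribute (+ k) (+ u) t)

  g^ℤ-factor : ∀ a b → g^ℤ b ≈ g^ℤ a * g^ℤ (b ℤ.- a)
  g^ℤ-factor a b = trans (reflexive (≡.cong g^ℤ_ (a+[b-a] a b))) (g^ℤ-+ a (b ℤ.- a))
    where
      a+[b-a] : ∀ a b → b ≡ a ℤ.+ (b ℤ.- a)
      a+[b-a] = ℤ-Solver.solve-∀

  [g^a+g^b≈g^a*x]≡[1+g^[b-a]≈x] : ∀ a b x → [ g^ℤ a + g^ℤ b ≈ g^ℤ a * x ] ≡ [ 1# + g^ℤ (b ℤ.- a) ≈ x ]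
  [g^a+g^b≈g^a*x]≡[1+g^[b-a]≈x] a b x = ≡.trans ([≈]-congˡ _ (+-congˡ (g^ℤ-factor a b)))
    (χ-cong (x+xy≈xz⇒1+y≈z (g^ℤ-≉0 a)) 1+y≈z⇒x+xy≈xz _ _)

  pairCount : ℤ → ℤ → Carrier → ℕ
  pairCount a b x = ∑² f (λ u₁ u₂ → [ g^ℤ ku+ u₁ a + g^ℤ ku+ u₂ b ≈ x ])

  pairCount-g^ℤ : ∀ a b c → pairCount a b (g^ℤ c) ≡ cyc F g k f (b ℤ.- a) (c ℤ.- a)
  pairCount-g^ℤ a b c = begin
    pairCount a b (g^ℤ c)                       ≡⟨ ∑-cong f (λ u₁ → ∑-cong f (divide-by-g^ u₁)) ⟩
    ∑ f (λ u₁ → ∑ f (λ u₂ → [ 1# + g^ℤ (ku+ u₂ b ℤ.- ku+ u₁ a) ≈ g^ℤ (c ℤ.- ku+ u₁ a) ])) ≡⟨ ∑-cong f recentre ⟩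
    ∑ f (λ u₁ → ψ (ℤ.- + u₁))                   ≡⟨ ∑-negate f ψ ψ-periodic ⟩
    ∑ f (ψ ∘ +_)                                ≡⟨ ∑-comm f f _ ⟩
    cyc F g k f (b ℤ.- a) (c ℤ.- a)             ∎
    where
      open ≡-Reasoning
      ψ : ℤ → ℕ
      ψ z = ∑ f (λ u₂ → [ 1# + g^ℤ ku+ u₂ (b ℤ.- a) ≈ g^ℤ (+ k ℤ.* z ℤ.+ (c ℤ.- a)) ])
      ψ-periodic : Periodic f ψ
      ψ-periodic z = ∑-cong f (λ u₂ → [≈]-congʳ _ (g^ℤ-periodic z (c ℤ.- a)))
      divide-by-g^ : ∀ u₁ u₂ → [ g^ℤ ku+ u₁ a + g^ℤ ku+ u₂ b ≈ g^ℤ c ]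
                             ≡ [ 1# + g^ℤ (ku+ u₂ b ℤ.- ku+ u₁ a) ≈ g^ℤ (c ℤ.- ku+ u₁ a) ]
      divide-by-g^ u₁ u₂ = ≡.trans ([≈]-congʳ _ (g^ℤ-factor (ku+ u₁ a) c))
                                   ([g^a+g^b≈g^a*x]≡[1+g^[b-a]≈x] (ku+ u₁ a) (ku+ u₂ b) _)
      recentre : ∀ u₁ → ∑ f (λ u₂ → [ 1# + g^ℤ (ku+ u₂ b ℤ.- ku+ u₁ a) ≈ g^ℤ (c ℤ.- ku+ u₁ a) ]) ≡ ψ (ℤ.- + u₁)
      recentre u₁ = begin
        ∑ f (λ u₂ → [ 1# + g^ℤ (ku+ u₂ b ℤ.- A) ≈ g^ℤ (c ℤ.- A) ])  ≡⟨ ∑-cong f (λ u₂ → ≡.cong (λ w → [ 1# + g^ℤ w ≈ _ ]) (regroup (+ k) (+ u₂) b A)) ⟩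
        ∑ f (λ u₂ → [ 1# + g^ℤ ku+ u₂ (b ℤ.- A) ≈ g^ℤ (c ℤ.- A) ])  ≡⟨ ∑-coset-invariant (λ x → [ 1# + x ≈ _ ]) (λ x≈y → [≈]-congˡ _ (+-congˡ x≈y)) (b ℤ.- A) (b ℤ.- a) k∣ku₁ ⟩
        ∑ f (λ u₂ → [ 1# + g^ℤ ku+ u₂ (b ℤ.- a) ≈ g^ℤ (c ℤ.- A) ])  ≡⟨ ∑-cong f (λ u₂ → ≡.cong (λ w → [ _ ≈ g^ℤ w ]) (negate (+ k) (+ u₁) a c)) ⟩
        ψ (ℤ.- + u₁)                                                 ∎
        where
          A = ku+ u₁ a
          regroup : ∀ k u b A → k ℤ.* u ℤ.+ b ℤ.- A ≡ k ℤ.* u ℤ.+ (b ℤ.- A)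
          regroup = ℤ-Solver.solve-∀
          difference : ∀ k u a b → b ℤ.- a ℤ.- (b ℤ.- (k ℤ.* u ℤ.+ a)) ≡ u ℤ.* k
          difference = ℤ-Solver.solve-∀
          k∣ku₁ : + k ∣ℤ b ℤ.- a ℤ.- (b ℤ.- A)
          k∣ku₁ = divides (+ u₁) (difference (+ k) (+ u₁) a b)
          negate : ∀ k u a c → c ℤ.- (k ℤ.* u ℤ.+ a) ≡ k ℤ.* (ℤ.- u) ℤ.+ (c ℤ.- a)
          negate = ℤ-Solver.solve-∀

  ∑-powers-select : ∀ s → ¬ s ≈ 0# → (A : Carrier → ℕ) → (∀ {x y} → x ≈ y → A x ≡ A y) →
                    ∑ n (λ c → [ s ≈ g^ c ] ℕ.* A (g^ c)) ≡ A s
  ∑-powers-select s s≉0 A A-cong with g^ℤ-surjective s s≉0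
  ... | c₀ , c₀<n , s≈g^c₀ = begin
    ∑ n (λ c → [ s ≈ g^ c ] ℕ.* A (g^ c))  ≡⟨ ∑-single n c₀ c₀<n others ⟩
    [ s ≈ g^ c₀ ] ℕ.* A (g^ c₀)           ≡⟨ ≡.cong (ℕ._* A (g^ c₀)) ([≈]-yes s≈g^c₀) ⟩
    A (g^ c₀) ℕ.+ 0                        ≡⟨ ℕ.+-identityʳ _ ⟩
    A (g^ c₀)                              ≡⟨ A-cong (sym s≈g^c₀) ⟩
    A s                                    ∎
    where
      open ≡-Reasoning
      others : ∀ c → c < n → c ≢ c₀ → [ s ≈ g^ c ] ℕ.* A (g^ c) ≡ 0
      others c c<n c≢c₀ = ≡.cong (ℕ._* A (g^ c))
        ([≈]-no {s} {g^ c} (λ s≈g^c → c≢c₀ (g^-injective c<n c₀<n (trans (sym s≈g^c) s≈g^c₀))))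

  powerPairs : Carrier → Carrier → ℕ
  powerPairs s t = ∑² n (λ c d → [ g^ c + g^ d ≈ 1# ] ℕ.* ([ s ≈ g^ c ] ℕ.* [ t ≈ g^ d ]))

  powerPairs-≉0 : ∀ {s t} → ¬ s ≈ 0# → ¬ t ≈ 0# → powerPairs s t ≡ [ s + t ≈ 1# ]
  powerPairs-≉0 {s} {t} s≉0 t≉0 = begin
    powerPairs s t                                                    ≡⟨ ∑-cong n (λ c → ≡.trans (∑-cong n (reorder c)) (∑-*ˡ n [ s ≈ g^ c ] (λ d → [ t ≈ g^ d ] ℕ.* [ g^ c + g^ d ≈ 1# ]))) ⟩
    ∑ n (λ c → [ s ≈ g^ c ] ℕ.* ∑ n (λ d → [ t ≈ g^ d ] ℕ.* [ g^ c + g^ d ≈ 1# ])) ≡⟨ ∑-powers-select s s≉0 _ (λ x≈y → ∑-cong n (λ d → ≡.cong ([ t ≈ g^ d ] ℕ.*_) ([≈]-congˡ _ (+-congʳ x≈y)))) ⟩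
    ∑ n (λ d → [ t ≈ g^ d ] ℕ.* [ s + g^ d ≈ 1# ])                    ≡⟨ ∑-powers-select t t≉0 _ (λ x≈y → [≈]-congˡ _ (+-congˡ x≈y)) ⟩
    [ s + t ≈ 1# ]                                                    ∎
    where
      open ≡-Reasoning
      rotate : ∀ a b c → a ℕ.* (b ℕ.* c) ≡ b ℕ.* (c ℕ.* a)
      rotate = ℕ-Solver.solve-∀
      reorder : ∀ c d → [ g^ c + g^ d ≈ 1# ] ℕ.* ([ s ≈ g^ c ] ℕ.* [ t ≈ g^ d ])
                      ≡ [ s ≈ g^ c ] ℕ.* ([ t ≈ g^ d ] ℕ.* [ g^ c + g^ d ≈ 1# ])
      reorder c d = rotate [ g^ c + g^ d ≈ 1# ] [ s ≈ g^ c ] [ t ≈ g^ d ]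

  powerPairs-0ˡ : ∀ {s} t → s ≈ 0# → powerPairs s t ≡ 0
  powerPairs-0ˡ {s} t s≈0 = ∑-≡0 n (λ c _ → ∑-≡0 n (λ d _ →
    ≡.trans (≡.cong (λ z → [ g^ c + g^ d ≈ 1# ] ℕ.* (z ℕ.* [ t ≈ g^ d ]))
                    ([≈]-no {s} {g^ c} (λ s≈g^c → g^-≉0 c (trans (sym s≈g^c) s≈0))))
            (ℕ.*-zeroʳ [ g^ c + g^ d ≈ 1# ])))

  powerPairs-0ʳ : ∀ s {t} → t ≈ 0# → powerPairs s t ≡ 0
  powerPairs-0ʳ s {t} t≈0 = ∑-≡0 n (λ c _ → ∑-≡0 n (λ d _ →
    ≡.trans (≡.cong (λ z → [ g^ c + g^ d ≈ 1# ] ℕ.* ([ s ≈ g^ c ] ℕ.* z))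
                    ([≈]-no {t} {g^ d} (λ t≈g^d → g^-≉0 d (trans (sym t≈g^d) t≈0))))
            (≡.trans (≡.cong ([ g^ c + g^ d ≈ 1# ] ℕ.*_) (ℕ.*-zeroʳ [ s ≈ g^ c ])) (ℕ.*-zeroʳ [ g^ c + g^ d ≈ 1# ]))))

  [+≈1]-decompose : ∀ s t → [ s + t ≈ 1# ]
    ≡ [ s ≈ 0# ] ℕ.* [ t ≈ 1# ] ℕ.+ [ s ≈ 1# ] ℕ.* [ t ≈ 0# ] ℕ.+ powerPairs s t
  [+≈1]-decompose s t = cases (s ≟ 0#) (t ≟ 0#)
   where
    cases : Dec (s ≈ 0#) → Dec (t ≈ 0#) → [ s + t ≈ 1# ]
          ≡ [ s ≈ 0# ] ℕ.* [ t ≈ 1# ] ℕ.+ [ s ≈ 1# ] ℕ.* [ t ≈ 0# ] ℕ.+ powerPairs s t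
    cases (yes s≈0) _ = ≡.sym (begin
      [ s ≈ 0# ] ℕ.* [ t ≈ 1# ] ℕ.+ [ s ≈ 1# ] ℕ.* [ t ≈ 0# ] ℕ.+ powerPairs s t
        ≡⟨ ≡.cong₂ (λ a b → a ℕ.* [ t ≈ 1# ] ℕ.+ b ℕ.* [ t ≈ 0# ] ℕ.+ powerPairs s t)
                   ([≈]-yes s≈0) ([≈]-no (0≉1 ∘ trans (sym s≈0))) ⟩
      1 ℕ.* [ t ≈ 1# ] ℕ.+ 0 ℕ.* [ t ≈ 0# ] ℕ.+ powerPairs s t
        ≡⟨ ≡.cong (1 ℕ.* [ t ≈ 1# ] ℕ.+ 0 ℕ.* [ t ≈ 0# ] ℕ.+_) (powerPairs-0ˡ t s≈0) ⟩
      1 ℕ.* [ t ≈ 1# ] ℕ.+ 0 ℕ.* [ t ≈ 0# ] ℕ.+ 0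
        ≡⟨ 1a+0b+0≡a [ t ≈ 1# ] [ t ≈ 0# ] ⟩
      [ t ≈ 1# ]
        ≡⟨ [≈]-congˡ _ (trans (+-congʳ s≈0) (+-identityˡ t)) ⟨
      [ s + t ≈ 1# ] ∎)
      where
        open ≡-Reasoning
        1a+0b+0≡a : ∀ a b → 1 ℕ.* a ℕ.+ 0 ℕ.* b ℕ.+ 0 ≡ a
        1a+0b+0≡a = ℕ-Solver.solve-∀
    cases (no s≉0) (yes t≈0) = ≡.sym (begin
      [ s ≈ 0# ] ℕ.* [ t ≈ 1# ] ℕ.+ [ s ≈ 1# ] ℕ.* [ t ≈ 0# ] ℕ.+ powerPairs s t
        ≡⟨ ≡.cong₂ (λ a b → a ℕ.* [ t ≈ 1# ] ℕ.+ [ s ≈ 1# ] ℕ.* b ℕ.+ powerPairs s t)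
                   ([≈]-no s≉0) ([≈]-yes t≈0) ⟩
      0 ℕ.* [ t ≈ 1# ] ℕ.+ [ s ≈ 1# ] ℕ.* 1 ℕ.+ powerPairs s t
        ≡⟨ ≡.cong (0 ℕ.* [ t ≈ 1# ] ℕ.+ [ s ≈ 1# ] ℕ.* 1 ℕ.+_) (powerPairs-0ʳ s t≈0) ⟩
      0 ℕ.* [ t ≈ 1# ] ℕ.+ [ s ≈ 1# ] ℕ.* 1 ℕ.+ 0
        ≡⟨ 0a+b1+0≡b [ t ≈ 1# ] [ s ≈ 1# ] ⟩
      [ s ≈ 1# ]
        ≡⟨ [≈]-congˡ _ (trans (+-congˡ t≈0) (+-identityʳ s)) ⟨
      [ s + t ≈ 1# ] ∎)
      where
        open ≡-Reasoning
        0a+b1+0≡b : ∀ a b → 0 ℕ.* a ℕ.+ b ℕ.* 1 ℕ.+ 0 ≡ b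
        0a+b1+0≡b = ℕ-Solver.solve-∀
    cases (no s≉0) (no t≉0) = ≡.sym (begin
      [ s ≈ 0# ] ℕ.* [ t ≈ 1# ] ℕ.+ [ s ≈ 1# ] ℕ.* [ t ≈ 0# ] ℕ.+ powerPairs s t
        ≡⟨ ≡.cong₂ (λ a b → a ℕ.* [ t ≈ 1# ] ℕ.+ [ s ≈ 1# ] ℕ.* b ℕ.+ powerPairs s t)
                   ([≈]-no s≉0) ([≈]-no t≉0) ⟩
      0 ℕ.* [ t ≈ 1# ] ℕ.+ [ s ≈ 1# ] ℕ.* 0 ℕ.+ powerPairs s t
        ≡⟨ 0a+b0+c≡c [ t ≈ 1# ] [ s ≈ 1# ] (powerPairs s t) ⟩
      powerPairs s t
        ≡⟨ powerPairs-≉0 s≉0 t≉0 ⟩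
      [ s + t ≈ 1# ] ∎)
      where
        open ≡-Reasoning
        0a+b0+c≡c : ∀ a b c → 0 ℕ.* a ℕ.+ b ℕ.* 0 ℕ.+ c ≡ c
        0a+b0+c≡c = ℕ-Solver.solve-∀

  ClassFunction : (ℤ → ℕ) → Set
  ClassFunction P = ∀ y y′ → + k ∣ℤ y′ ℤ.- y → P y ≡ P y′

  -- Write c = k w₁ + v₁ and d = k w₂ + v₂; the weights depend only on v₁, v₂, and the
  -- remaining count over w₁, w₂ is a cyclotomic number.
  ∑²-powers-class : ∀ {P Q} → ClassFunction P → ClassFunction Q →
    ∑² n (λ c d → [ g^ c + g^ d ≈ 1# ] ℕ.* (P (+ c) ℕ.* Q (+ d)))
      ≡ ∑² k (λ v₁ v₂ → cyc F g k f (+ v₂ ℤ.- + v₁) (ℤ.- + v₁) ℕ.* P (+ v₁) ℕ.* Q (+ v₂))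
  ∑²-powers-class {P} {Q} P-class Q-class = begin
    ∑² n (λ c d → [ g^ c + g^ d ≈ 1# ] ℕ.* (P (+ c) ℕ.* Q (+ d)))
      ≡⟨ ∑²-split-* k f _ ⟩
    ∑² k (λ v₁ v₂ → ∑² f (λ w₁ w₂ → [ g^ (k ℕ.* w₁ ℕ.+ v₁) + g^ (k ℕ.* w₂ ℕ.+ v₂) ≈ 1# ]
                                     ℕ.* (P (+ (k ℕ.* w₁ ℕ.+ v₁)) ℕ.* Q (+ (k ℕ.* w₂ ℕ.+ v₂)))))
      ≡⟨ ∑²-cong k (λ v₁ v₂ → ∑²-cong f (λ w₁ w₂ → to-residues w₁ v₁ w₂ v₂)) ⟩
    ∑² k (λ v₁ v₂ → ∑² f (λ w₁ w₂ → [ g^ℤ ku+ w₁ (+ v₁) + g^ℤ ku+ w₂ (+ v₂) ≈ 1# ]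
                                     ℕ.* (P (+ v₁) ℕ.* Q (+ v₂))))
      ≡⟨ ∑²-cong k (λ v₁ v₂ → ∑²-*ʳ f _ _) ⟩
    ∑² k (λ v₁ v₂ → pairCount (+ v₁) (+ v₂) (g^ℤ (+ 0)) ℕ.* (P (+ v₁) ℕ.* Q (+ v₂)))
      ≡⟨ ∑²-cong k (λ v₁ v₂ → ≡.cong (ℕ._* _) (pairCount-g^ℤ (+ v₁) (+ v₂) (+ 0))) ⟩
    ∑² k (λ v₁ v₂ → cyc F g k f (+ v₂ ℤ.- + v₁) (+ 0 ℤ.- + v₁) ℕ.* (P (+ v₁) ℕ.* Q (+ v₂)))
      ≡⟨ ∑²-cong k (λ v₁ v₂ → ≡.cong (λ y → cyc F g k f (+ v₂ ℤ.- + v₁) y ℕ.* (P (+ v₁) ℕ.* Q (+ v₂))) (ℤ.+-identityˡ (ℤ.- + v₁))) ⟩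
    ∑² k (λ v₁ v₂ → cyc F g k f (+ v₂ ℤ.- + v₁) (ℤ.- + v₁) ℕ.* (P (+ v₁) ℕ.* Q (+ v₂)))
      ≡⟨ ∑²-cong k (λ v₁ v₂ → ℕ.*-assoc (cyc F g k f (+ v₂ ℤ.- + v₁) (ℤ.- + v₁)) (P (+ v₁)) (Q (+ v₂))) ⟨
    ∑² k (λ v₁ v₂ → cyc F g k f (+ v₂ ℤ.- + v₁) (ℤ.- + v₁) ℕ.* P (+ v₁) ℕ.* Q (+ v₂)) ∎
    where
      open ≡-Reasoning
      +[kw+v]≡ku+ : ∀ w v → + (k ℕ.* w ℕ.+ v) ≡ ku+ w (+ v)
      +[kw+v]≡ku+ w v = ≡.trans (ℤ.pos-+ (k ℕ.* w) v) (≡.cong (ℤ._+ + v) (ℤ.pos-* k w))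
      difference : ∀ k w v → v ℤ.- (k ℤ.* w ℤ.+ v) ≡ ℤ.- w ℤ.* k
      difference = ℤ-Solver.solve-∀
      k∣v-[kw+v] : ∀ w v → + k ∣ℤ + v ℤ.- + (k ℕ.* w ℕ.+ v)
      k∣v-[kw+v] w v = divides (ℤ.- + w)
        (≡.trans (≡.cong (λ z → + v ℤ.- z) (+[kw+v]≡ku+ w v)) (difference (+ k) (+ w) (+ v)))
      to-residues : ∀ w₁ v₁ w₂ v₂ →
           [ g^ (k ℕ.* w₁ ℕ.+ v₁) + g^ (k ℕ.* w₂ ℕ.+ v₂) ≈ 1# ] ℕ.* (P (+ (k ℕ.* w₁ ℕ.+ v₁)) ℕ.* Q (+ (k ℕ.* w₂ ℕ.+ v₂)))
         ≡ [ g^ℤ ku+ w₁ (+ v₁) + g^ℤ ku+ w₂ (+ v₂) ≈ 1# ] ℕ.* (P (+ v₁) ℕ.* Q (+ v₂))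
      to-residues w₁ v₁ w₂ v₂ =
        ≡.cong₂ ℕ._*_ (≡.cong₂ (λ a b → [ g^ℤ a + g^ℤ b ≈ 1# ]) (+[kw+v]≡ku+ w₁ v₁) (+[kw+v]≡ku+ w₂ v₂))
                      (≡.cong₂ ℕ._*_ (P-class _ _ (k∣v-[kw+v] w₁ v₁)) (Q-class _ _ (k∣v-[kw+v] w₂ v₂)))

  cyc4-split : ∀ i₁ i₂ i₃ i₄ → cyc4 F g k f i₁ i₂ i₃ i₄
    ≡ pairCount i₁ i₂ 0# ℕ.* pairCount i₃ i₄ 1# ℕ.+ pairCount i₁ i₂ 1# ℕ.* pairCount i₃ i₄ 0#
      ℕ.+ ∑² n (λ c d → [ g^ c + g^ d ≈ 1# ] ℕ.* (pairCount i₁ i₂ (g^ c) ℕ.* pairCount i₃ i₄ (g^ d)))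
  cyc4-split i₁ i₂ i₃ i₄ = begin
    cyc4 F g k f i₁ i₂ i₃ i₄
      ≡⟨ ∑²-cong f (λ a b → ∑²-cong f (λ c d → [≈]-congˡ _ (+-assoc (s a b) _ _))) ⟩
    ∑²∑² (λ a b c d → [ s a b + t c d ≈ 1# ])
      ≡⟨ ∑²-cong f (λ a b → ∑²-cong f (λ c d → [+≈1]-decompose (s a b) (t c d))) ⟩
    ∑²∑² (λ a b c d → [ s a b ≈ 0# ] ℕ.* [ t c d ≈ 1# ] ℕ.+ [ s a b ≈ 1# ] ℕ.* [ t c d ≈ 0# ]
                      ℕ.+ powerPairs (s a b) (t c d))
      ≡⟨ ∑²∑²-distrib-+ _ _ ⟩
    ∑²∑² (λ a b c d → [ s a b ≈ 0# ] ℕ.* [ t c d ≈ 1# ] ℕ.+ [ s a b ≈ 1# ] ℕ.* [ t c d ≈ 0# ])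
      ℕ.+ ∑²∑² (λ a b c d → powerPairs (s a b) (t c d))
      ≡⟨ ≡.cong₂ ℕ._+_ (≡.trans (∑²∑²-distrib-+ _ _) (≡.cong₂ ℕ._+_ (∑²-product f f _ _) (∑²-product f f _ _)))
                       ∑²∑²-powerPairs ⟩
    pairCount i₁ i₂ 0# ℕ.* pairCount i₃ i₄ 1# ℕ.+ pairCount i₁ i₂ 1# ℕ.* pairCount i₃ i₄ 0#
      ℕ.+ ∑² n (λ c d → [ g^ c + g^ d ≈ 1# ] ℕ.* (pairCount i₁ i₂ (g^ c) ℕ.* pairCount i₃ i₄ (g^ d))) ∎
    where
      open ≡-Reasoning
      s t : ℕ → ℕ → Carrier
      s a b = g^ℤ ku+ a i₁ + g^ℤ ku+ b i₂
      t c d = g^ℤ ku+ c i₃ + g^ℤ ku+ d i₄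
      ∑²∑² : (ℕ → ℕ → ℕ → ℕ → ℕ) → ℕ
      ∑²∑² H = ∑² f (λ a b → ∑² f (H a b))
      ∑²∑²-distrib-+ : ∀ H H′ → ∑²∑² (λ a b c d → H a b c d ℕ.+ H′ a b c d) ≡ ∑²∑² H ℕ.+ ∑²∑² H′
      ∑²∑²-distrib-+ H H′ = ≡.trans (∑²-cong f (λ a b → ∑²-distrib-+ f (H a b) (H′ a b))) (∑²-distrib-+ f _ _)
      ∑²∑²-powerPairs : ∑²∑² (λ a b c d → powerPairs (s a b) (t c d))
        ≡ ∑² n (λ c d → [ g^ c + g^ d ≈ 1# ] ℕ.* (pairCount i₁ i₂ (g^ c) ℕ.* pairCount i₃ i₄ (g^ d)))
      ∑²∑²-powerPairs = begin
        ∑²∑² (λ a b c d → powerPairs (s a b) (t c d))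
          ≡⟨ ∑²-cong f (λ a b → ∑²-comm f n _) ⟩
        ∑² f (λ a b → ∑² n (λ x y → ∑² f (λ c d → [ g^ x + g^ y ≈ 1# ] ℕ.* ([ s a b ≈ g^ x ] ℕ.* [ t c d ≈ g^ y ]))))
          ≡⟨ ∑²-comm f n _ ⟩
        ∑² n (λ x y → ∑²∑² (λ a b c d → [ g^ x + g^ y ≈ 1# ] ℕ.* ([ s a b ≈ g^ x ] ℕ.* [ t c d ≈ g^ y ])))
          ≡⟨ ∑²-cong n (λ x y → ≡.trans (∑²-cong f (λ a b → ∑²-*ˡ f [ g^ x + g^ y ≈ 1# ] (λ c d → [ s a b ≈ g^ x ] ℕ.* [ t c d ≈ g^ y ])))
                                        (∑²-*ˡ f [ g^ x + g^ y ≈ 1# ] _)) ⟩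
        ∑² n (λ x y → [ g^ x + g^ y ≈ 1# ] ℕ.* ∑²∑² (λ a b c d → [ s a b ≈ g^ x ] ℕ.* [ t c d ≈ g^ y ]))
          ≡⟨ ∑²-cong n (λ x y → ≡.cong ([ g^ x + g^ y ≈ 1# ] ℕ.*_) (∑²-product f f _ _)) ⟩
        ∑² n (λ x y → [ g^ x + g^ y ≈ 1# ] ℕ.* (pairCount i₁ i₂ (g^ x) ℕ.* pairCount i₃ i₄ (g^ y))) ∎

  pairCount-1 : ∀ a b → pairCount a b 1# ≡ cyc F g k f (b ℤ.- a) (ℤ.- a)
  pairCount-1 a b = ≡.trans (pairCount-g^ℤ a b (+ 0)) (≡.cong (cyc F g k f (b ℤ.- a)) (ℤ.+-identityˡ (ℤ.- a)))

  cyc-class : ∀ x i → ClassFunction (λ y → cyc F g k f x (y ℤ.- i))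
  cyc-class x i y y′ k∣y′-y = cyc-cong x (≡.subst (+ k ∣ℤ_) (≡.sym (cancel y y′ i)) k∣y′-y)
    where
      cancel : ∀ y y′ i → y′ ℤ.- i ℤ.- (y ℤ.- i) ≡ y′ ℤ.- y
      cancel = ℤ-Solver.solve-∀

  private
    γ-term : ℤ → ℤ → ℕ
    γ-term i j = cyc F g k f (j ℤ.- i) (ℤ.- i) ℕ.* f

  γ-as-sum : ∀ i₁ i₂ i₃ i₄ → γ F g k f i₁ i₂ i₃ i₄
    ≡ χ ((i₄ ℤ.- i₃) ≡? half F g k f [mod k ]) ℕ.* (cyc F g k f (i₂ ℤ.- i₁) (ℤ.- i₁) ℕ.* f)
      ℕ.+ χ ((i₂ ℤ.- i₁) ≡? half F g k f [mod k ]) ℕ.* (cyc F g k f (i₄ ℤ.- i₃) (ℤ.- i₃) ℕ.* f)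
  γ-as-sum i₁ i₂ i₃ i₄ with (i₂ ℤ.- i₁) ≡? half F g k f [mod k ] | (i₄ ℤ.- i₃) ≡? half F g k f [mod k ]
  ... | yes _ | yes _ = ≡.cong₂ ℕ._+_ (≡.sym (ℕ.+-identityʳ (γ-term i₁ i₂))) (≡.sym (ℕ.+-identityʳ (γ-term i₃ i₄)))
  ... | no _  | yes _ = ≡.sym (≡.trans (ℕ.+-identityʳ (γ-term i₁ i₂ ℕ.+ 0)) (ℕ.+-identityʳ (γ-term i₁ i₂)))
  ... | yes _ | no _  = ≡.sym (ℕ.+-identityʳ (γ-term i₃ i₄))
  ... | no _  | no _  = ≡.refl

  θ-as-sum : ∀ i → θ F g k f i ≡ χ (2 ℕ∣.∣? f) ℕ.* (cyc F g k f (+ 0) (ℤ.- i) ℕ.* f)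
  θ-as-sum i with 2 ℕ∣.∣? f
  ... | yes _ = ≡.sym (ℕ.+-identityʳ (cyc F g k f (+ 0) (ℤ.- i) ℕ.* f))
  ... | no _  = ≡.refl

  module _ (2∣n : 2 ∣ n) where
    h : ℕ
    h = n / 2

    h+h≡n : h ℕ.+ h ≡ n
    h+h≡n = begin
      h ℕ.+ h        ≡⟨ ≡.cong (h ℕ.+_) (ℕ.+-identityʳ h) ⟨
      2 ℕ.* h        ≡⟨ ℕ.*-comm 2 h ⟩
      n / 2 ℕ.* 2    ≡⟨ m/n*n≡m 2∣n ⟩
      n              ∎
      where open ≡-Reasoning

    open HalfOrder h h+h≡n

    [1+g^ℤ≈0]≡[n∣-h] : ∀ w → [ 1# + g^ℤ w ≈ 0# ] ≡ χ (+ n ∣ℤ? w ℤ.- + h)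
    [1+g^ℤ≈0]≡[n∣-h] w = χ-cong (1+g^ℤ≈0⇒n∣-h w) (n∣-h⇒1+g^ℤ≈0 w) _ _

    pairCount-0 : ∀ a b → pairCount a b 0# ≡ χ ((b ℤ.- a) ≡? + h [mod k ]) ℕ.* f
    pairCount-0 a b = begin
      pairCount a b 0#                                   ≡⟨ ∑-cong f (λ u₁ → ∑-cong f (as-multiple u₁)) ⟩
      ∑ f (λ u₁ → ∑ f (λ u₂ → χ (+ n ∣ℤ? ku+ u₂ (b ℤ.- ku+ u₁ a ℤ.- + h)))) ≡⟨ ∑-cong f (λ u₁ → ∑-multiples _) ⟩
      ∑ f (λ u₁ → χ (+ k ∣ℤ? b ℤ.- ku+ u₁ a ℤ.- + h))   ≡⟨ ∑-cong f (λ u₁ → χ-cong (k∣⇒k∣ u₁) (k∣⇐k∣ u₁) _ _) ⟩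
      ∑ f (λ _ → χ ((b ℤ.- a) ≡? + h [mod k ]))        ≡⟨ ∑-const f _ ⟩
      f ℕ.* χ ((b ℤ.- a) ≡? + h [mod k ])              ≡⟨ ℕ.*-comm f _ ⟩
      χ ((b ℤ.- a) ≡? + h [mod k ]) ℕ.* f              ∎
      where
        open ≡-Reasoning
        regroup : ∀ k u₂ b A h → k ℤ.* u₂ ℤ.+ b ℤ.- A ℤ.- h ≡ k ℤ.* u₂ ℤ.+ (b ℤ.- A ℤ.- h)
        regroup = ℤ-Solver.solve-∀
        as-multiple : ∀ u₁ u₂ → [ g^ℤ ku+ u₁ a + g^ℤ ku+ u₂ b ≈ 0# ]
                              ≡ χ (+ n ∣ℤ? ku+ u₂ (b ℤ.- ku+ u₁ a ℤ.- + h))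
        as-multiple u₁ u₂ = begin
          [ g^ℤ A + g^ℤ B ≈ 0# ]                 ≡⟨ [≈]-congʳ _ (zeroʳ (g^ℤ A)) ⟨
          [ g^ℤ A + g^ℤ B ≈ g^ℤ A * 0# ]         ≡⟨ [g^a+g^b≈g^a*x]≡[1+g^[b-a]≈x] A B 0# ⟩
          [ 1# + g^ℤ (B ℤ.- A) ≈ 0# ]            ≡⟨ [1+g^ℤ≈0]≡[n∣-h] (B ℤ.- A) ⟩
          χ (+ n ∣ℤ? B ℤ.- A ℤ.- + h)            ≡⟨ ≡.cong (χ ∘ (+ n ∣ℤ?_)) (regroup (+ k) (+ u₂) b A (+ h)) ⟩
          χ (+ n ∣ℤ? ku+ u₂ (b ℤ.- A ℤ.- + h))   ∎
          where
            A = ku+ u₁ a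
            B = ku+ u₂ b
        shift : ∀ k u a b h → b ℤ.- a ℤ.- h ≡ b ℤ.- (k ℤ.* u ℤ.+ a) ℤ.- h ℤ.+ k ℤ.* u
        shift = ℤ-Solver.solve-∀
        unshift : ∀ k u a b h → b ℤ.- (k ℤ.* u ℤ.+ a) ℤ.- h ≡ b ℤ.- a ℤ.- h ℤ.- k ℤ.* u
        unshift = ℤ-Solver.solve-∀
        k∣⇒k∣ : ∀ u₁ → + k ∣ℤ b ℤ.- ku+ u₁ a ℤ.- + h → (b ℤ.- a) ≡ + h [mod k ]
        k∣⇒k∣ u₁ k∣ = ∣⇒∣ᵤ (≡.subst (+ k ∣ℤ_) (≡.sym (shift (+ k) (+ u₁) a b (+ h))) (ℤ∣.∣m∣n⇒∣m+n k∣ (k∣k* (+ u₁))))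
        k∣⇐k∣ : ∀ u₁ → (b ℤ.- a) ≡ + h [mod k ] → + k ∣ℤ b ℤ.- ku+ u₁ a ℤ.- + h
        k∣⇐k∣ u₁ k∣ = ≡.subst (+ k ∣ℤ_) (≡.sym (unshift (+ k) (+ u₁) a b (+ h))) (ℤ∣.∣m∣n⇒∣m-n (∣ᵤ⇒∣ {i = b ℤ.- a ℤ.- + h} k∣) (k∣k* (+ u₁)))

    cyc4-formula : ∀ i₁ i₂ i₃ i₄ → cyc4 F g k f i₁ i₂ i₃ i₄
      ≡ γ F g k f i₁ i₂ i₃ i₄ ℕ.+ ∑² k (λ v₁ v₂ →
          cyc F g k f (+ v₂ ℤ.- + v₁) (ℤ.- + v₁)
          ℕ.* cyc F g k f (i₂ ℤ.- i₁) (+ v₁ ℤ.- i₁) ℕ.* cyc F g k f (i₄ ℤ.- i₃) (+ v₂ ℤ.- i₃))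
    cyc4-formula i₁ i₂ i₃ i₄ = begin
      cyc4 F g k f i₁ i₂ i₃ i₄
        ≡⟨ cyc4-split i₁ i₂ i₃ i₄ ⟩
      pairCount i₁ i₂ 0# ℕ.* pairCount i₃ i₄ 1# ℕ.+ pairCount i₁ i₂ 1# ℕ.* pairCount i₃ i₄ 0#
        ℕ.+ ∑² n (λ c d → [ g^ c + g^ d ≈ 1# ] ℕ.* (pairCount i₁ i₂ (g^ c) ℕ.* pairCount i₃ i₄ (g^ d)))
        ≡⟨ ≡.cong₂ ℕ._+_ (≡.cong₂ ℕ._+_ (≡.cong₂ ℕ._*_ (pairCount-0 i₁ i₂) (pairCount-1 i₃ i₄))
                                          (≡.cong₂ ℕ._*_ (pairCount-1 i₁ i₂) (pairCount-0 i₃ i₄)))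
                         (∑²-cong n (λ c d → ≡.cong ([ g^ c + g^ d ≈ 1# ] ℕ.*_)
                            (≡.cong₂ ℕ._*_ (pairCount-g^ℤ i₁ i₂ (+ c)) (pairCount-g^ℤ i₃ i₄ (+ d))))) ⟩
      χ D₁₂ ℕ.* f ℕ.* C₃₄ ℕ.+ C₁₂ ℕ.* (χ D₃₄ ℕ.* f)
        ℕ.+ ∑² n (λ c d → [ g^ c + g^ d ≈ 1# ]
                          ℕ.* (cyc F g k f (i₂ ℤ.- i₁) (+ c ℤ.- i₁) ℕ.* cyc F g k f (i₄ ℤ.- i₃) (+ d ℤ.- i₃)))
        ≡⟨ ≡.cong₂ ℕ._+_ (≡.trans (rearrange (χ D₁₂) (χ D₃₄) C₃₄ C₁₂ f) (≡.sym (γ-as-sum i₁ i₂ i₃ i₄)))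
                         (∑²-powers-class (cyc-class (i₂ ℤ.- i₁) i₁) (cyc-class (i₄ ℤ.- i₃) i₃)) ⟩
      γ F g k f i₁ i₂ i₃ i₄ ℕ.+ ∑² k (λ v₁ v₂ →
          cyc F g k f (+ v₂ ℤ.- + v₁) (ℤ.- + v₁)
          ℕ.* cyc F g k f (i₂ ℤ.- i₁) (+ v₁ ℤ.- i₁) ℕ.* cyc F g k f (i₄ ℤ.- i₃) (+ v₂ ℤ.- i₃)) ∎
      where
        open ≡-Reasoning
        D₁₂ = (i₂ ℤ.- i₁) ≡? + h [mod k ]
        D₃₄ = (i₄ ℤ.- i₃) ≡? + h [mod k ]
        C₁₂ = cyc F g k f (i₂ ℤ.- i₁) (ℤ.- i₁)
        C₃₄ = cyc F g k f (i₄ ℤ.- i₃) (ℤ.- i₃)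
        rearrange : ∀ a b x y f → a ℕ.* f ℕ.* x ℕ.+ y ℕ.* (b ℕ.* f) ≡ b ℕ.* (y ℕ.* f) ℕ.+ a ℕ.* (x ℕ.* f)
        rearrange = ℕ-Solver.solve-∀

    k∣h⇒2∣f : k ∣ h → 2 ∣ f
    k∣h⇒2∣f (ℕ∣.divides s h≡s*k) = ℕ∣.divides s (ℕ.*-cancelˡ-≡ f (s ℕ.* 2) k (begin
      k ℕ.* f              ≡⟨ h+h≡n ⟨
      h ℕ.+ h              ≡⟨ ≡.cong₂ ℕ._+_ h≡s*k h≡s*k ⟩
      s ℕ.* k ℕ.+ s ℕ.* k  ≡⟨ double s k ⟩
      k ℕ.* (s ℕ.* 2)      ∎))
      where
        open ≡-Reasoning
        double : ∀ s k → s ℕ.* k ℕ.+ s ℕ.* k ≡ k ℕ.* (s ℕ.* 2)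
        double = ℕ-Solver.solve-∀

    2∣f⇒k∣h : 2 ∣ f → k ∣ h
    2∣f⇒k∣h (ℕ∣.divides t f≡t*2) = ℕ∣.divides t (ℕ.*-cancelʳ-≡ h (t ℕ.* k) 2 (begin
      h ℕ.* 2              ≡⟨ ℕ.*-comm h 2 ⟩
      h ℕ.+ (h ℕ.+ 0)      ≡⟨ ≡.cong (h ℕ.+_) (ℕ.+-identityʳ h) ⟩
      h ℕ.+ h              ≡⟨ h+h≡n ⟩
      k ℕ.* f              ≡⟨ ≡.cong (k ℕ.*_) f≡t*2 ⟩
      k ℕ.* (t ℕ.* 2)      ≡⟨ regroup k t ⟩
      t ℕ.* k ℕ.* 2        ∎))
      where
        open ≡-Reasoning
        regroup : ∀ k t → k ℕ.* (t ℕ.* 2) ≡ t ℕ.* k ℕ.* 2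
        regroup = ℕ-Solver.solve-∀

    γ-diagonal : ∀ i → γ F g k f i i i i ≡ 2 ℕ.* θ F g k f i
    γ-diagonal i = begin
      γ F g k f i i i i                ≡⟨ γ-as-sum i i i i ⟩
      χ D ℕ.* C ℕ.+ χ D ℕ.* C          ≡⟨ ≡.cong (λ x → x ℕ.+ x) (≡.cong₂ ℕ._*_ D⇔2∣f C≡) ⟩
      θ′ ℕ.+ θ′                        ≡⟨ ≡.cong (λ x → x ℕ.+ x) (θ-as-sum i) ⟨
      θ F g k f i ℕ.+ θ F g k f i      ≡⟨ ≡.cong (θ F g k f i ℕ.+_) (ℕ.+-identityʳ _) ⟨
      2 ℕ.* θ F g k f i                ∎
      where
        open ≡-Reasoning
        D = (i ℤ.- i) ≡? half F g k f [mod k ]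
        C = cyc F g k f (i ℤ.- i) (ℤ.- i) ℕ.* f
        θ′ = χ (2 ℕ∣.∣? f) ℕ.* (cyc F g k f (+ 0) (ℤ.- i) ℕ.* f)
        ∣i-i-h∣≡h : ∣ i ℤ.- i ℤ.- + h ∣ ≡ h
        ∣i-i-h∣≡h = begin
          ∣ i ℤ.- i ℤ.- + h ∣  ≡⟨ ≡.cong (λ z → ∣ z ℤ.- + h ∣) (ℤ.+-inverseʳ i) ⟩
          ∣ + 0 ℤ.- + h ∣      ≡⟨ ≡.cong ∣_∣ (ℤ.+-identityˡ (ℤ.- + h)) ⟩
          ∣ ℤ.- + h ∣          ≡⟨ ℤ.∣-i∣≡∣i∣ (+ h) ⟩
          h                    ∎
        D⇔2∣f : χ D ≡ χ (2 ℕ∣.∣? f)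
        D⇔2∣f = χ-cong (λ k∣ → k∣h⇒2∣f (≡.subst (k ∣_) ∣i-i-h∣≡h k∣))
                       (λ 2∣f → ≡.subst (k ∣_) (≡.sym ∣i-i-h∣≡h) (2∣f⇒k∣h 2∣f)) D (2 ℕ∣.∣? f)
        C≡ : C ≡ cyc F g k f (+ 0) (ℤ.- i) ℕ.* f
        C≡ = ≡.cong (λ z → cyc F g k f z (ℤ.- i) ℕ.* f) (ℤ.+-inverseʳ i)

    cyc4-diagonal : ∀ i → cyc4 F g k f i i i i
      ≡ 2 ℕ.* θ F g k f i ℕ.+ ∑² k (λ v₁ v₂ →
          cyc F g k f (+ v₂ ℤ.- + v₁) (ℤ.- + v₁)
          ℕ.* cyc F g k f (+ 0) (+ v₁ ℤ.- i) ℕ.* cyc F g k f (+ 0) (+ v₂ ℤ.- i))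
    cyc4-diagonal i = ≡.trans (cyc4-formula i i i i) (≡.cong₂ ℕ._+_ (γ-diagonal i)
      (∑²-cong k (λ v₁ v₂ → ≡.cong (λ z → cyc F g k f (+ v₂ ℤ.- + v₁) (ℤ.- + v₁)
                                          ℕ.* cyc F g k f z (+ v₁ ℤ.- i) ℕ.* cyc F g k f z (+ v₂ ℤ.- i))
                                   (ℤ.+-inverseʳ i))))

odd-^ : ∀ {p} → ¬ 2 ∣ p → ∀ m → ¬ 2 ∣ p ^ m
odd-^ p-odd zero    2∣1 with ℕ∣.∣1⇒≡1 2∣1
... | ()
odd-^ p-odd (suc m) 2∣pᵐ⁺¹ with euclidsLemma _ _ prime[2] 2∣pᵐ⁺¹
... | inj₁ 2∣p  = p-odd 2∣p
... | inj₂ 2∣pᵐ = odd-^ p-odd m 2∣pᵐ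

even⊎odd : ∀ x → (2 ∣ x) ⊎ (2 ∣ suc x)
even⊎odd zero    = inj₁ (2 ℕ∣.∣0)
even⊎odd (suc x) with even⊎odd x
... | inj₁ (ℕ∣.divides t x≡t*2) = inj₂ (ℕ∣.divides (suc t) (≡.cong (suc ∘ suc) x≡t*2))
... | inj₂ 2∣1+x                 = inj₁ 2∣1+x

lemma2p15 : ∀ {c ℓ : Level} (p m q k f : ℕ) (F : DecField c ℓ) (g : DecField.Carrier F) →
    Prime p → ¬ (2 ∣ p) → m ≥ 1 → q ≡ p ^ m → HasSize F q →
    k ≥ 1 → f ≥ 1 → q ℕ.∸ 1 ≡ k ℕ.* f → IsGenerator F g →
    (∀ (i₁ i₂ i₃ i₄ : ℤ) →
      cyc4 F g k f i₁ i₂ i₃ i₄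
        ≡ γ F g k f i₁ i₂ i₃ i₄
          ℕ.+ ∑ k (λ v₁ → ∑ k (λ v₂ →
              cyc F g k f ((+ v₂) ℤ.- (+ v₁)) (ℤ.- (+ v₁))
              ℕ.* cyc F g k f (i₂ ℤ.- i₁) ((+ v₁) ℤ.- i₁)
              ℕ.* cyc F g k f (i₄ ℤ.- i₃) ((+ v₂) ℤ.- i₃))))
    × (∀ (i : ℤ) →
      cyc4 F g k f i i i i
        ≡ 2 ℕ.* θ F g k f i
          ℕ.+ ∑ k (λ v₁ → ∑ k (λ v₂ →
              cyc F g k f ((+ v₂) ℤ.- (+ v₁)) (ℤ.- (+ v₁))
              ℕ.* cyc F g k f (+ 0) ((+ v₁) ℤ.- i)
              ℕ.* cyc F g k f (+ 0) ((+ v₂) ℤ.- i))))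
lemma2p15 p m zero     k f F g _ _     _ _    _    k≥1 f≥1 0≡kf   _   =
  ⊥-elim (ℕ.<⇒≢ (ℕ.*-mono-≤ k≥1 f≥1) 0≡kf)
lemma2p15 p m (suc q′) k f F g _ p-odd _ q≡pᵐ size k≥1 f≥1 ≡.refl gen =
  cyc4-formula 2∣kf , cyc4-diagonal 2∣kf
  where
    instance
      k≢0 : NonZero k
      k≢0 = ℕ.>-nonZero k≥1
      f≢0 : NonZero f
      f≢0 = ℕ.>-nonZero f≥1
    open CosetCounting F g k f size gen
    2∣kf : 2 ∣ k ℕ.* f
    2∣kf with even⊎odd (k ℕ.* f)
    ... | inj₁ 2∣kf   = 2∣kf
    ... | inj₂ 2∣1+kf = ⊥-elim (odd-^ p-odd m (≡.subst (2 ∣_) q≡pᵐ 2∣1+kf))
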